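{- Let $b>1$ be an integer, $A\subsetneq\{0,\dots,b-1\}$ with $A\neq\{0\}$, $N=\#A$, and $\gamma_j=\sum_{a\in A}a^j$ for $j\geq1$. Let $\mathcal{A}$ be the set of admissible non-negative integers (all base-$b$ digits, without leading zeros, lie in $A$; $0$ is admissible iff $0\in A$), and for a non-negative integer $n$ let $l(n)$ be the smallest non-negative integer $l$ with $n<b^l$. Define the measure $\mu$ on $[0,\infty)$ by $$\mu=\sum_{l\geq0}b^{ -l}\sum_{n\in\mathcal{A}}\delta_{n/b^l}\ \text{ if }0\in A,\qquad \mu=\delta_0+\sum_{l\geq0}b^{ -l}\sum_{n\in\mathcal{A},\,l(n)\geq l}\delta_{n/b^l}\ \text{ if }0\notin A,$$ and let $u_m=\int_{[0,1)}x^m\,d\mu(x)$. Then for all $m\geq1$, $$(b^{m+1}-N)\,u_m=\sum_{j=1}^m\binom{m}{j}\gamma_j u_{m-j},$$ and $u_0=\frac{b}{b-N}$, $u_1=\frac{\sum_{a\in A}a}{b^2-N}\cdot\frac{b}{b-N}$.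
   Context: $\delta_x$ denotes the Dirac point mass at $x$. -}

module Defs where

open import Data.Bool using (Bool; true; false; if_then_else_; _∧_; _∨_; not)
open import Data.Nat as ℕ using (ℕ; zero; suc; NonZero; _≤_; _<ᵇ_)
open import Data.Nat.DivMod using (_mod_; _/_)
open import Data.Nat.Combinatorics using (_C_)
open import Data.Fin using (Fin; toℕ)
open import Data.Fin.Subset using (Subset; ∣_∣)
open import Data.Fin.Subset.Properties using (_∈?_)
open import Data.List using (List; []; _∷_; map; filter; foldr; upTo; applyUpTo; allFin)
open import Data.Integer using (+_)
open import Data.Rational as ℚ using (ℚ; 0ℚ; 1ℚ; _+_; _*_; _-_)
open import Data.Product using (∃; _×_)
open import Relation.Nullary using (does)
open import Relation.Binary.PropositionalEquality using (_≡_)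

ℕ→ℚ : ℕ → ℚ
ℕ→ℚ n = + n ℚ./ 1

-- powers of a rational, with x ^ 0 = 1 (so 0 ^ 0 = 1)
infixr 8 _^ℚ_
_^ℚ_ : ℚ → ℕ → ℚ
x ^ℚ zero  = 1ℚ
x ^ℚ suc n = x * (x ^ℚ n)

sumℚ : List ℚ → ℚ
sumℚ = foldr _+_ 0ℚ

module _ (b : ℕ) .{{_ : NonZero b}} (A : Subset b) where

  digitIn : ℕ → Bool
  digitIn d = does ((d mod b) ∈? A)

  digitsIn : (fuel n : ℕ) → Bool
  digitsIn zero     n       = true
  digitsIn (suc f)  zero    = true
  digitsIn (suc f)  (suc k) = digitIn (suc k) ∧ digitsIn f (suc k / b)

  admissible : ℕ → Bool
  admissible zero    = digitIn 0
  admissible (suc k) = digitsIn (suc k) (suc k)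

  -- l(n): smallest l with n < b^l (computed with fuel n+1, which suffices as b > 1)
  lenAux : (fuel l : ℕ) → ℕ → ℕ
  lenAux zero    l n = l
  lenAux (suc f) l n = if n <ᵇ b ℕ.^ l then l else lenAux f (suc l) n

  len : ℕ → ℕ
  len n = lenAux (suc n) 0 n

  zeroInA : Bool
  zeroInA = digitIn 0

  -- does the atom n / b^l of μ occur at level l?  (for 0 ∉ A: requires l(n) ≥ l)
  -- (the restriction n < b^l, i.e. n/b^l ∈ [0,1), is imposed in levelTerm)
  levelAtom : ℕ → ℕ → Bool
  levelAtom l n = admissible n ∧ (zeroInA ∨ not (len n ℕ.<ᵇ l))

  invb : ℚ
  invb = + 1 ℚ./ b

  -- contribution of level l of μ to ∫_{[0,1)} x^m dμ:
  -- b^{-l} Σ_{n admissible, n < b^l (i.e. n/b^l ∈ [0,1)), and l(n) ≥ l if 0 ∉ A} (n/b^l)^m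
  levelTerm : (m l : ℕ) → ℚ
  levelTerm m l =
    (invb ^ℚ l) *
    sumℚ (map (λ n → if levelAtom l n then (ℕ→ℚ n * (invb ^ℚ l)) ^ℚ m else 0ℚ)
              (upTo (b ℕ.^ l)))

  -- the δ₀ term present when 0 ∉ A: ∫_{[0,1)} x^m dδ₀ = 0^m
  deltaTerm : ℕ → ℚ
  deltaTerm m = if zeroInA then 0ℚ else 0ℚ ^ℚ m

  -- partial sums of ∫_{[0,1)} x^m dμ over levels l < L
  partialU : (m L : ℕ) → ℚ
  partialU m L = deltaTerm m + sumℚ (applyUpTo (levelTerm m) L)

  γ : ℕ → ℕ
  γ j = foldr ℕ._+_ 0 (map (λ a → if does (a ∈? A) then toℕ a ℕ.^ j else 0) (allFin b))

  N : ℕ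
  N = ∣ A ∣

  sumA : ℕ
  sumA = foldr ℕ._+_ 0 (map (λ a → if does (a ∈? A) then toℕ a else 0) (allFin b))

ConvergesTo : (ℕ → ℚ) → ℚ → Set
ConvergesTo s q = ∀ (ε : ℚ) → 0ℚ ℚ.< ε → ∃ λ L₀ → ∀ L → L₀ ≤ L → ℚ.∣ s L - q ∣ ℚ.< ε

sum1to : ℕ → (ℕ → ℚ) → ℚ
sum1to m f = sumℚ (applyUpTo (λ i → f (suc i)) m)

module Submission where

-- Restricted to [0,1), μ is self-similar: the atoms of level l + 1 are the points (d + x)/b with
-- d ∈ A and x an atom of level l, and the weight drops by 1/b. Expanding ((d + x)/b)^m by the
-- binomial theorem, the m-th moment w_m(l) of level l satisfies
--   w_m(l + 1) = b^-(m+1) Σ_{j ≤ m} C(m,j) γ_j w_{m-j}(l),   w_m(0) = 0^m,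
-- so the partial sums Q_m(L) = Σ_{l < L} w_m(l) satisfy the same affine recursion in m, with L
-- shifted by one. Its fixed point is the solution u of
--   (b^(m+1) - N) u_m = b^(m+1) 0^m + Σ_{1 ≤ j ≤ m} C(m,j) γ_j u_{m-j},
-- and the errors u_m - Q_m(L) obey the homogeneous recursion. There the diagonal coefficient is
-- N/b^(m+1) ≤ N/b < 1, so by induction on m every error decays geometrically in L.

open import Defs
open import Algebra.Bundles using (Semiring; Ring)
import Algebra.Definitions.RawMonoid as RawMonoid
import Algebra.Properties.Semiring.Binomial as Binomial
import Algebra.Properties.Semiring.Exp as Exp
open import Data.Bool using (Bool; true; false; if_then_else_; _∧_; _∨_; not; T)
open import Data.Bool.Properties using (∧-assoc; ∧-comm; ∧-zeroʳ; ∧-identityʳ)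
open import Data.Empty using (⊥-elim)
open import Data.Fin as Fin using (Fin; toℕ)
import Data.Fin.Properties as Fin
open import Data.Fin.Subset using (Subset; ⊤; ⁅_⁆; _⊂_) renaming (∣_∣ to ∣_∣ˢ)
open import Data.Fin.Subset.Properties using (_∈?_; p⊂q⇒∣p∣<∣q∣; ∣⊤∣≡n)
open import Data.Integer as ℤ using (+≤+; +<+)
import Data.Integer.Properties as ℤ
open import Data.List using (map; foldr; applyUpTo; upTo; tabulate; allFin)
import Data.List.Properties as List
open import Data.Nat as ℕ using (ℕ; zero; suc; NonZero; z≤n; s≤s; z<s)
import Data.Nat.Properties as ℕ
open import Data.Nat.Combinatorics using (_C_)
open import Data.Nat.Coprimality as Coprime using (1-coprimeTo)
open import Data.Nat.Divisibility using (divides-refl)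
open import Data.Nat.DivMod
  using (_/_; _%_; _mod_; m%n<n; m<n⇒m%n≡m; [m+kn]%n≡m%n; +-distrib-/-∣ʳ; m*n/n≡m; m<n*o⇒m/o<n;
         m<n⇒m/n≡0; 0/n≡0; /-monoˡ-≤)
open import Data.Nat.Tactic.RingSolver using (solve-∀)
open import Data.Product using (∃; _,_; _×_; proj₁; proj₂)
open import Data.Rational as ℚ using (ℚ; mkℚ; 0ℚ; 1ℚ; _+_; _*_; _-_; -_; _≤_; _<_; ∣_∣)
import Data.Rational.Properties as ℚ
open import Data.Rational.Solver using (module +-*-Solver)
open +-*-Solver using (solve; _:=_; _:+_; _:*_; _:-_; :-_; con)
import Data.Rational.Unnormalised as ℚᵘ
import Data.Rational.Unnormalised.Properties as ℚᵘ
open import Data.Sum using ([_,_]′)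
import Data.Vec as Vec
open import Function using (_∘_)
open import Relation.Binary.PropositionalEquality
open import Relation.Nullary using (does; yes; no)
open import Relation.Nullary.Decidable using (dec-true; dec-false)

ℚ-semiring : Semiring _ _
ℚ-semiring = Ring.semiring ℚ.+-*-ring

open import Algebra.Properties.Semiring.Sum ℚ-semiring
  using (sum; sum-syntax; sum-cong-≗; ∑-comm; *-distribˡ-sum; *-distribʳ-sum)

private
  ι : ℕ → ℚ
  ι n = mkℚ (ℤ.+ n) 0 (Coprime.sym (1-coprimeTo n))

ℕ→ℚ≡mkℚ : ∀ n → ℕ→ℚ n ≡ mkℚ (ℤ.+ n) 0 (Coprime.sym (1-coprimeTo n))
ℕ→ℚ≡mkℚ n = ℚ.↥p/↧p≡p (ι n)

ℕ→ℚ-+ : ∀ m n → ℕ→ℚ (m ℕ.+ n) ≡ ℕ→ℚ m + ℕ→ℚ n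
ℕ→ℚ-+ m n rewrite ℕ→ℚ≡mkℚ m | ℕ→ℚ≡mkℚ n | ℕ→ℚ≡mkℚ (m ℕ.+ n) =
  ℚ.toℚᵘ-injective (ℚᵘ.≃-sym (ℚᵘ.≃-trans (ℚ.toℚᵘ-homo-+ (ι m) (ι n)) (ℚᵘ.*≡* eq)))
  where
  open ≡-Reasoning
  eq : (ℤ.+ m ℤ.* ℤ.+ 1 ℤ.+ ℤ.+ n ℤ.* ℤ.+ 1) ℤ.* ℤ.+ 1 ≡ ℤ.+ (m ℕ.+ n) ℤ.* (ℤ.+ 1 ℤ.* ℤ.+ 1)
  eq = begin
    (ℤ.+ m ℤ.* ℤ.+ 1 ℤ.+ ℤ.+ n ℤ.* ℤ.+ 1) ℤ.* ℤ.+ 1 ≡⟨ ℤ.*-identityʳ _ ⟩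
    ℤ.+ m ℤ.* ℤ.+ 1 ℤ.+ ℤ.+ n ℤ.* ℤ.+ 1             ≡⟨ cong₂ ℤ._+_ (ℤ.*-identityʳ (ℤ.+ m)) (ℤ.*-identityʳ (ℤ.+ n)) ⟩
    ℤ.+ m ℤ.+ ℤ.+ n                                 ≡⟨ ℤ.*-identityʳ _ ⟨
    ℤ.+ (m ℕ.+ n) ℤ.* (ℤ.+ 1 ℤ.* ℤ.+ 1)             ∎

ℕ→ℚ-* : ∀ m n → ℕ→ℚ (m ℕ.* n) ≡ ℕ→ℚ m * ℕ→ℚ n
ℕ→ℚ-* m n rewrite ℕ→ℚ≡mkℚ m | ℕ→ℚ≡mkℚ n | ℕ→ℚ≡mkℚ (m ℕ.* n) =
  ℚ.toℚᵘ-injective (ℚᵘ.≃-sym (ℚᵘ.≃-trans (ℚ.toℚᵘ-homo-* (ι m) (ι n))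
    (ℚᵘ.*≡* (cong (ℤ._* ℤ.+ 1) (sym (ℤ.pos-* m n))))))

ℕ→ℚ-^ : ∀ m n → ℕ→ℚ (m ℕ.^ n) ≡ ℕ→ℚ m ^ℚ n
ℕ→ℚ-^ m zero    = refl
ℕ→ℚ-^ m (suc n) = trans (ℕ→ℚ-* m (m ℕ.^ n)) (cong (ℕ→ℚ m *_) (ℕ→ℚ-^ m n))

ℕ→ℚ-mono-≤ : ∀ {m n} → m ℕ.≤ n → ℕ→ℚ m ≤ ℕ→ℚ n
ℕ→ℚ-mono-≤ {m} {n} m≤n rewrite ℕ→ℚ≡mkℚ m | ℕ→ℚ≡mkℚ n =
  ℚ.*≤* (subst₂ ℤ._≤_ (sym (ℤ.*-identityʳ (ℤ.+ m))) (sym (ℤ.*-identityʳ (ℤ.+ n))) (+≤+ m≤n))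

ℕ→ℚ-mono-< : ∀ {m n} → m ℕ.< n → ℕ→ℚ m < ℕ→ℚ n
ℕ→ℚ-mono-< {m} {n} m<n rewrite ℕ→ℚ≡mkℚ m | ℕ→ℚ≡mkℚ n =
  ℚ.*<* (subst₂ ℤ._<_ (sym (ℤ.*-identityʳ (ℤ.+ m))) (sym (ℤ.*-identityʳ (ℤ.+ n))) (+<+ m<n))

0≤ℕ→ℚ : ∀ n → 0ℚ ≤ ℕ→ℚ n
0≤ℕ→ℚ n = ℕ→ℚ-mono-≤ {0} {n} z≤n

ℕ→ℚ*1/n≡1 : ∀ n .{{_ : NonZero n}} → ℕ→ℚ n * (ℤ.+ 1 ℚ./ n) ≡ 1ℚ
ℕ→ℚ*1/n≡1 (suc k) = trans
  (cong₂ _*_ (ℕ→ℚ≡mkℚ (suc k)) (ℚ.↥p/↧p≡p (mkℚ (ℤ.+ 1) k (1-coprimeTo (suc k)))))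
  (ℚ.*-inverseʳ (ι (suc k)))

0<1/n : ∀ n .{{_ : NonZero n}} → 0ℚ < ℤ.+ 1 ℚ./ n
0<1/n (suc k) = subst (0ℚ <_) (sym (ℚ.↥p/↧p≡p (mkℚ (ℤ.+ 1) k (1-coprimeTo (suc k))))) (ℚ.positive⁻¹ _)

*-monoˡ-≤-0≤ : ∀ {r p q} → 0ℚ ≤ r → p ≤ q → r * p ≤ r * q
*-monoˡ-≤-0≤ {r} 0≤r = ℚ.*-monoˡ-≤-nonNeg r {{ℚ.nonNegative 0≤r}}

*-monoʳ-≤-0≤ : ∀ {r p q} → 0ℚ ≤ r → p ≤ q → p * r ≤ q * r
*-monoʳ-≤-0≤ {r} 0≤r = ℚ.*-monoʳ-≤-nonNeg r {{ℚ.nonNegative 0≤r}}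

*-nonNeg : ∀ {p q} → 0ℚ ≤ p → 0ℚ ≤ q → 0ℚ ≤ p * q
*-nonNeg {p} {q} 0≤p 0≤q = ℚ.≤-trans (ℚ.≤-reflexive (sym (ℚ.*-zeroʳ p))) (*-monoˡ-≤-0≤ 0≤p 0≤q)

*-pos : ∀ {p q} → 0ℚ < p → 0ℚ < q → 0ℚ < p * q
*-pos {p} {q} 0<p 0<q =
  ℚ.positive⁻¹ (p * q) {{ℚ.pos*pos⇒pos p {{ℚ.positive 0<p}} q {{ℚ.positive 0<q}}}}

+-nonNeg : ∀ {p q} → 0ℚ ≤ p → 0ℚ ≤ q → 0ℚ ≤ p + q
+-nonNeg 0≤p 0≤q = ℚ.+-mono-≤ 0≤p 0≤q

p≤p+q : ∀ {p q} → 0ℚ ≤ q → p ≤ p + q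
p≤p+q {p} 0≤q = ℚ.≤-trans (ℚ.≤-reflexive (sym (ℚ.+-identityʳ p))) (ℚ.+-monoʳ-≤ p 0≤q)

p≤q+p : ∀ {p q} → 0ℚ ≤ q → p ≤ q + p
p≤q+p {p} 0≤q = ℚ.≤-trans (ℚ.≤-reflexive (sym (ℚ.+-identityˡ p))) (ℚ.+-monoˡ-≤ p 0≤q)

p≤q⇒0≤q-p : ∀ {p q} → p ≤ q → 0ℚ ≤ q - p
p≤q⇒0≤q-p {p} {q} p≤q = begin
  0ℚ    ≡⟨ ℚ.+-inverseʳ p ⟨
  p - p ≤⟨ ℚ.+-monoˡ-≤ (- p) p≤q ⟩
  q - p ∎
  where open ℚ.≤-Reasoning

p<q⇒0<q-p : ∀ {p q} → p < q → 0ℚ < q - p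
p<q⇒0<q-p {p} {q} p<q = begin-strict
  0ℚ    ≡⟨ ℚ.+-inverseʳ p ⟨
  p - p <⟨ ℚ.+-monoˡ-< (- p) p<q ⟩
  q - p ∎
  where open ℚ.≤-Reasoning

∣c*x∣≡c*∣x∣ : ∀ {c} x → 0ℚ ≤ c → ∣ c * x ∣ ≡ c * ∣ x ∣
∣c*x∣≡c*∣x∣ {c} x 0≤c = trans (ℚ.∣p*q∣≡∣p∣*∣q∣ c x) (cong (_* ∣ x ∣) (ℚ.0≤p⇒∣p∣≡p 0≤c))

^ℚ-distribʳ-* : ∀ x y n → (x * y) ^ℚ n ≡ x ^ℚ n * y ^ℚ n
^ℚ-distribʳ-* x y zero    = refl
^ℚ-distribʳ-* x y (suc n) = trans (cong ((x * y) *_) (^ℚ-distribʳ-* x y n))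
  (solve 4 (λ x y a b → (x :* y) :* (a :* b) := (x :* a) :* (y :* b)) refl x y (x ^ℚ n) (y ^ℚ n))

1^ℚn≡1 : ∀ n → 1ℚ ^ℚ n ≡ 1ℚ
1^ℚn≡1 zero    = refl
1^ℚn≡1 (suc n) = trans (cong (1ℚ *_) (1^ℚn≡1 n)) (ℚ.*-identityˡ 1ℚ)

0^ℚsuc≡0 : ∀ n → 0ℚ ^ℚ suc n ≡ 0ℚ
0^ℚsuc≡0 n = ℚ.*-zeroˡ (0ℚ ^ℚ n)

^ℚ-nonNeg : ∀ {x} n → 0ℚ ≤ x → 0ℚ ≤ x ^ℚ n
^ℚ-nonNeg zero    0≤x = ℚ.nonNegative⁻¹ 1ℚ
^ℚ-nonNeg (suc n) 0≤x = *-nonNeg 0≤x (^ℚ-nonNeg n 0≤x)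

^ℚ-≤1 : ∀ {x} → 0ℚ ≤ x → x ≤ 1ℚ → ∀ n → x ^ℚ n ≤ 1ℚ
^ℚ-≤1 0≤x x≤1 zero    = ℚ.≤-refl
^ℚ-≤1 {x} 0≤x x≤1 (suc n) = begin
  x * x ^ℚ n ≤⟨ *-monoˡ-≤-0≤ 0≤x (^ℚ-≤1 0≤x x≤1 n) ⟩
  x * 1ℚ     ≡⟨ ℚ.*-identityʳ x ⟩
  x          ≤⟨ x≤1 ⟩
  1ℚ         ∎
  where open ℚ.≤-Reasoning

^ℚ-antimonoʳ-≤ : ∀ {x} → 0ℚ ≤ x → x ≤ 1ℚ → ∀ {m n} → m ℕ.≤ n → x ^ℚ n ≤ x ^ℚ m
^ℚ-antimonoʳ-≤ 0≤x x≤1 {n = n} z≤n = ^ℚ-≤1 0≤x x≤1 n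
^ℚ-antimonoʳ-≤ 0≤x x≤1 (s≤s m≤n) = *-monoˡ-≤-0≤ 0≤x (^ℚ-antimonoʳ-≤ 0≤x x≤1 m≤n)

ℕ→ℚ-unbounded : ∀ x → ∃ λ n → x < ℕ→ℚ n
ℕ→ℚ-unbounded x@(mkℚ (ℤ.+ a) d _) = suc a , subst (x <_) (sym (ℕ→ℚ≡mkℚ (suc a)))
  (ℚ.*<* (subst₂ ℤ._<_ (ℤ.pos-* a 1) (ℤ.pos-* (suc a) (suc d)) (+<+ a*1<[1+a]*[1+d])))
  where
  a*1<[1+a]*[1+d] : a ℕ.* 1 ℕ.< suc a ℕ.* suc d
  a*1<[1+a]*[1+d] = ℕ.<-≤-trans (s≤s (ℕ.≤-reflexive (ℕ.*-identityʳ a))) (ℕ.m≤m*n (suc a) (suc d))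
ℕ→ℚ-unbounded (mkℚ ℤ.-[1+ a ] d _) = 0 , ℚ.*<* ℤ.-<+

archimedean : ∀ x {y} → 0ℚ < y → ∃ λ n → x < ℕ→ℚ n * y
archimedean x {y} 0<y = n , (begin-strict
  x                 ≡⟨ x≡x/y*y ⟩
  x * 1/y * y       <⟨ ℚ.*-monoˡ-<-pos y {{ℚ.positive 0<y}} x/y<n ⟩
  ℕ→ℚ n * y         ∎)
  where
  open ℚ.≤-Reasoning
  instance
    y≢0 : ℚ.NonZero y
    y≢0 = ℚ.>-nonZero 0<y
  1/y : ℚ
  1/y = ℚ.1/ y
  n : ℕ
  n = proj₁ (ℕ→ℚ-unbounded (x * 1/y))
  x/y<n : x * 1/y < ℕ→ℚ n
  x/y<n = proj₂ (ℕ→ℚ-unbounded (x * 1/y))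
  x≡x/y*y : x ≡ x * 1/y * y
  x≡x/y*y = sym (trans (ℚ.*-assoc x 1/y y) (trans (cong (x *_) (ℚ.*-inverseˡ y)) (ℚ.*-identityʳ x)))

𝟙[_] : Bool → ℚ
𝟙[ true  ] = 1ℚ
𝟙[ false ] = 0ℚ

if-then-0≡𝟙* : ∀ β x → (if β then x else 0ℚ) ≡ 𝟙[ β ] * x
if-then-0≡𝟙* true  x = sym (ℚ.*-identityˡ x)
if-then-0≡𝟙* false x = sym (ℚ.*-zeroˡ x)

𝟙-∧ : ∀ β β′ → 𝟙[ β ∧ β′ ] ≡ 𝟙[ β ] * 𝟙[ β′ ]
𝟙-∧ true  β′ = sym (ℚ.*-identityˡ 𝟙[ β′ ])
𝟙-∧ false β′ = sym (ℚ.*-zeroˡ 𝟙[ β′ ])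

sumℚ-applyUpTo : ∀ n f → sumℚ (applyUpTo f n) ≡ ∑[ i < n ] f (toℕ i)
sumℚ-applyUpTo zero    f = refl
sumℚ-applyUpTo (suc n) f = cong (f 0 +_) (sumℚ-applyUpTo n (f ∘ suc))

∑-split-+ : ∀ m n (f : ℕ → ℚ) →
  ∑[ i < m ℕ.+ n ] f (toℕ i) ≡ ∑[ i < m ] f (toℕ i) + ∑[ j < n ] f (m ℕ.+ toℕ j)
∑-split-+ zero    n f = sym (ℚ.+-identityˡ _)
∑-split-+ (suc m) n f = trans (cong (f 0 +_) (∑-split-+ m n (f ∘ suc))) (sym (ℚ.+-assoc (f 0) _ _))

∑-split-* : ∀ m n (f : ℕ → ℚ) →
  ∑[ i < m ℕ.* n ] f (toℕ i) ≡ ∑[ d < m ] ∑[ r < n ] f (toℕ d ℕ.* n ℕ.+ toℕ r)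
∑-split-* zero    n f = refl
∑-split-* (suc m) n f = begin
  ∑[ i < n ℕ.+ m ℕ.* n ] f (toℕ i)
    ≡⟨ ∑-split-+ n (m ℕ.* n) f ⟩
  ∑[ r < n ] f (toℕ r) + ∑[ i < m ℕ.* n ] f (n ℕ.+ toℕ i)
    ≡⟨ cong (∑[ r < n ] f (toℕ r) +_) (∑-split-* m n (λ i → f (n ℕ.+ i))) ⟩
  ∑[ r < n ] f (toℕ r) + ∑[ d < m ] ∑[ r < n ] f (n ℕ.+ (toℕ d ℕ.* n ℕ.+ toℕ r))
    ≡⟨ cong (∑[ r < n ] f (toℕ r) +_) (sum-cong-≗ {m} λ d → sum-cong-≗ {n} λ r →
         cong f (sym (ℕ.+-assoc n (toℕ d ℕ.* n) (toℕ r)))) ⟩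
  ∑[ d < suc m ] ∑[ r < n ] f (toℕ d ℕ.* n ℕ.+ toℕ r) ∎
  where open ≡-Reasoning

∑-mono-≤ : ∀ {n} {f g : Fin n → ℚ} → (∀ i → f i ≤ g i) → sum f ≤ sum g
∑-mono-≤ {zero}  f≤g = ℚ.≤-refl
∑-mono-≤ {suc n} f≤g = ℚ.+-mono-≤ (f≤g Fin.zero) (∑-mono-≤ (f≤g ∘ Fin.suc))

∑-nonNeg : ∀ {n} {f : Fin n → ℚ} → (∀ i → 0ℚ ≤ f i) → 0ℚ ≤ sum f
∑-nonNeg {zero}  0≤f = ℚ.≤-refl
∑-nonNeg {suc n} 0≤f = +-nonNeg (0≤f Fin.zero) (∑-nonNeg (0≤f ∘ Fin.suc))

∣∑∣≤∑∣∣ : ∀ {n} (f : Fin n → ℚ) → ∣ sum f ∣ ≤ ∑[ i < n ] ∣ f i ∣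
∣∑∣≤∑∣∣ {zero}  f = ℚ.≤-refl
∣∑∣≤∑∣∣ {suc n} f = ℚ.≤-trans (ℚ.∣p+q∣≤∣p∣+∣q∣ (f Fin.zero) _)
  (ℚ.+-monoʳ-≤ ∣ f Fin.zero ∣ (∣∑∣≤∑∣∣ (f ∘ Fin.suc)))

∑-distrib-- : ∀ {n} (f g : Fin n → ℚ) → ∑[ i < n ] (f i - g i) ≡ sum f - sum g
∑-distrib-- {zero}  f g = refl
∑-distrib-- {suc n} f g = trans
  (cong (f Fin.zero - g Fin.zero +_) (∑-distrib-- (f ∘ Fin.suc) (g ∘ Fin.suc)))
  (solve 4 (λ a b c d → (a :- b) :+ (c :- d) := (a :+ c) :- (b :+ d)) refl
     (f Fin.zero) (g Fin.zero) (sum (f ∘ Fin.suc)) (sum (g ∘ Fin.suc)))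

∑∑-* : ∀ {m n} c (f : Fin m → ℚ) (g : Fin n → ℚ) →
  ∑[ i < m ] ∑[ j < n ] (c * (f i * g j)) ≡ c * (sum f * sum g)
∑∑-* {m} {n} c f g = begin
  ∑[ i < m ] ∑[ j < n ] (c * (f i * g j)) ≡⟨ sum-cong-≗ {m} (λ i → sum-cong-≗ {n} (λ j →
                                                sym (ℚ.*-assoc c (f i) (g j)))) ⟩
  ∑[ i < m ] ∑[ j < n ] (c * f i * g j)   ≡⟨ sum-cong-≗ {m} (λ i → *-distribˡ-sum (c * f i) g) ⟨
  ∑[ i < m ] (c * f i * sum g)            ≡⟨ *-distribʳ-sum (sum g) (λ i → c * f i) ⟨
  ∑[ i < m ] (c * f i) * sum g            ≡⟨ cong (_* sum g) (*-distribˡ-sum c f) ⟨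
  c * sum f * sum g                       ≡⟨ ℚ.*-assoc c (sum f) (sum g) ⟩
  c * (sum f * sum g)                     ∎
  where open ≡-Reasoning

ℕ→ℚ-sum-tabulate : ∀ {n} (g : Fin n → ℕ) → ℕ→ℚ (foldr ℕ._+_ 0 (tabulate g)) ≡ ∑[ i < n ] ℕ→ℚ (g i)
ℕ→ℚ-sum-tabulate {zero}  g = refl
ℕ→ℚ-sum-tabulate {suc n} g =
  trans (ℕ→ℚ-+ (g Fin.zero) _) (cong (ℕ→ℚ (g Fin.zero) +_) (ℕ→ℚ-sum-tabulate (g ∘ Fin.suc)))

∣p∣≡count : ∀ {n} (p : Subset n) →
  ∣ p ∣ˢ ≡ foldr ℕ._+_ 0 (tabulate (λ a → if does (a ∈? p) then 1 else 0))
∣p∣≡count Vec.[]          = refl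
∣p∣≡count (true Vec.∷ p)  = cong suc (∣p∣≡count p)
∣p∣≡count (false Vec.∷ p) = ∣p∣≡count p

×≡ℕ→ℚ* : ∀ n x → RawMonoid._×_ ℚ.+-0-rawMonoid n x ≡ ℕ→ℚ n * x
×≡ℕ→ℚ* zero    x = sym (ℚ.*-zeroˡ x)
×≡ℕ→ℚ* (suc n) x = begin
  x + RawMonoid._×_ ℚ.+-0-rawMonoid n x ≡⟨ cong (x +_) (×≡ℕ→ℚ* n x) ⟩
  x + ℕ→ℚ n * x                         ≡⟨ solve 2 (λ x k → x :+ k :* x := (con 1ℚ :+ k) :* x) refl x (ℕ→ℚ n) ⟩
  (1ℚ + ℕ→ℚ n) * x                      ≡⟨ cong (_* x) (ℕ→ℚ-+ 1 n) ⟨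
  ℕ→ℚ (suc n) * x                       ∎
  where open ≡-Reasoning

binomial-theorem : ∀ x y n →
  (x + y) ^ℚ n ≡ ∑[ k < suc n ] (ℕ→ℚ (n C toℕ k) * (x ^ℚ toℕ k * y ^ℚ (n ℕ.∸ toℕ k)))
binomial-theorem x y n = begin
  (x + y) ^ℚ n           ≡⟨ ^≡^ℚ (x + y) n ⟨
  (x + y) ^ n            ≡⟨ Binomial.theorem ℚ-semiring x y (ℚ.*-comm x y) n ⟩
  Binomial.binomialExpansion ℚ-semiring x y n
    ≡⟨ sum-cong-≗ {suc n} (λ k → trans (×≡ℕ→ℚ* (n C toℕ k) _)
         (cong (ℕ→ℚ (n C toℕ k) *_) (cong₂ _*_ (^≡^ℚ x (toℕ k)) (^≡^ℚ y (n ℕ.∸ toℕ k))))) ⟩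
  ∑[ k < suc n ] (ℕ→ℚ (n C toℕ k) * (x ^ℚ toℕ k * y ^ℚ (n ℕ.∸ toℕ k))) ∎
  where
  open ≡-Reasoning
  open Exp ℚ-semiring using (_^_)
  ^≡^ℚ : ∀ x n → x ^ n ≡ x ^ℚ n
  ^≡^ℚ x zero    = refl
  ^≡^ℚ x (suc n) = cong (x *_) (^≡^ℚ x n)

-- Geometric decay

^ℚ-bernoulli : ∀ {τ} → 0ℚ ≤ τ → τ ≤ 1ℚ → ∀ L → τ ^ℚ L * (1ℚ + ℕ→ℚ L * (1ℚ - τ)) ≤ 1ℚ
^ℚ-bernoulli {τ} 0≤τ τ≤1 zero = ℚ.≤-reflexive
  (solve 1 (λ t → con 1ℚ :* (con 1ℚ :+ con 0ℚ :* (con 1ℚ :- t)) := con 1ℚ) refl τ)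
^ℚ-bernoulli {τ} 0≤τ τ≤1 (suc L) = begin
  τ ^ℚ suc L * (1ℚ + ℕ→ℚ (suc L) * δ) ≡⟨ cong (λ k → τ ^ℚ suc L * (1ℚ + k * δ)) (ℕ→ℚ-+ 1 L) ⟩
  τ * τ ^ℚ L * (1ℚ + (1ℚ + ℕ→ℚ L) * δ)
    ≡⟨ solve 3 (λ t p k → t :* p :* (con 1ℚ :+ (con 1ℚ :+ k) :* (con 1ℚ :- t))
                        := p :* (t :* ((con 1ℚ :+ k :* (con 1ℚ :- t)) :+ (con 1ℚ :- t))))
         refl τ (τ ^ℚ L) (ℕ→ℚ L) ⟩
  τ ^ℚ L * (τ * (X + δ))              ≤⟨ *-monoˡ-≤-0≤ (^ℚ-nonNeg L 0≤τ) τ[X+δ]≤X ⟩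
  τ ^ℚ L * X                          ≤⟨ ^ℚ-bernoulli 0≤τ τ≤1 L ⟩
  1ℚ                                  ∎
  where
  open ℚ.≤-Reasoning
  δ X : ℚ
  δ = 1ℚ - τ
  X = 1ℚ + ℕ→ℚ L * δ
  0≤δ : 0ℚ ≤ δ
  0≤δ = p≤q⇒0≤q-p τ≤1
  τ≤X : τ ≤ X
  τ≤X = ℚ.≤-trans τ≤1 (p≤p+q (*-nonNeg (0≤ℕ→ℚ L) 0≤δ))
  τ[X+δ]≤X : τ * (X + δ) ≤ X
  τ[X+δ]≤X = begin
    τ * (X + δ)               ≡⟨ ℚ.+-identityʳ _ ⟨
    τ * (X + δ) + 0ℚ          ≤⟨ ℚ.+-monoʳ-≤ (τ * (X + δ)) (*-nonNeg 0≤δ (p≤q⇒0≤q-p τ≤X)) ⟩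
    τ * (X + δ) + δ * (X - τ) ≡⟨ solve 2 (λ t x → t :* (x :+ (con 1ℚ :- t)) :+ (con 1ℚ :- t) :* (x :- t) := x)
                                   refl τ X ⟩
    X                         ∎

geometric-decay : ∀ {τ} → 0ℚ ≤ τ → τ < 1ℚ → ∀ {K ε} → 0ℚ ≤ K → 0ℚ < ε →
  ∃ λ L₀ → ∀ L → L₀ ℕ.≤ L → K * τ ^ℚ L < ε
geometric-decay {τ} 0≤τ τ<1 {K} {ε} 0≤K 0<ε = L₀ , λ L L₀≤L →
  ℚ.≤-<-trans (*-monoˡ-≤-0≤ 0≤K (^ℚ-antimonoʳ-≤ 0≤τ (ℚ.<⇒≤ τ<1) L₀≤L)) Kτ^L₀<ε
  where
  open ℚ.≤-Reasoning
  δ : ℚ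
  δ = 1ℚ - τ
  0<εδ : 0ℚ < ε * δ
  0<εδ = *-pos 0<ε (p<q⇒0<q-p τ<1)
  L₀ : ℕ
  L₀ = proj₁ (archimedean K 0<εδ)
  X : ℚ
  X = 1ℚ + ℕ→ℚ L₀ * δ
  0<X : 0ℚ < X
  0<X = ℚ.<-≤-trans (ℚ.positive⁻¹ 1ℚ) (p≤p+q (*-nonNeg (0≤ℕ→ℚ L₀) (p≤q⇒0≤q-p (ℚ.<⇒≤ τ<1))))
  Kτ^L₀<ε : K * τ ^ℚ L₀ < ε
  Kτ^L₀<ε = ℚ.*-cancelʳ-<-nonNeg X {{ℚ.nonNegative (ℚ.<⇒≤ 0<X)}} (begin-strict
    K * τ ^ℚ L₀ * X       ≡⟨ ℚ.*-assoc K _ X ⟩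
    K * (τ ^ℚ L₀ * X)     ≤⟨ *-monoˡ-≤-0≤ 0≤K (^ℚ-bernoulli 0≤τ (ℚ.<⇒≤ τ<1) L₀) ⟩
    K * 1ℚ                ≡⟨ ℚ.*-identityʳ K ⟩
    K                     <⟨ proj₂ (archimedean K 0<εδ) ⟩
    ℕ→ℚ L₀ * (ε * δ)      ≡⟨ solve 3 (λ l e d → l :* (e :* d) := con 0ℚ :+ e :* (l :* d)) refl (ℕ→ℚ L₀) ε δ ⟩
    0ℚ + ε * (ℕ→ℚ L₀ * δ) ≤⟨ ℚ.+-monoˡ-≤ (ε * (ℕ→ℚ L₀ * δ)) (ℚ.<⇒≤ 0<ε) ⟩
    ε + ε * (ℕ→ℚ L₀ * δ)  ≡⟨ solve 2 (λ e y → e :+ e :* y := e :* (con 1ℚ :+ y)) refl ε (ℕ→ℚ L₀ * δ) ⟩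
    ε * X                 ∎)

geometric-bound⇒convergesTo : ∀ {τ K} → 0ℚ ≤ τ → τ < 1ℚ → 0ℚ ≤ K → ∀ (s : ℕ → ℚ) q L₁ →
  (∀ L → L₁ ℕ.≤ L → ∣ s L - q ∣ ≤ K * τ ^ℚ L) → ConvergesTo s q
geometric-bound⇒convergesTo {τ} {K} 0≤τ τ<1 0≤K s q L₁ bound ε 0<ε = L₁ ℕ.⊔ L₀ , λ L L₁⊔L₀≤L →
  ℚ.≤-<-trans (bound L (ℕ.m⊔n≤o⇒m≤o L₁ L₀ L₁⊔L₀≤L)) (proj₂ decay L (ℕ.m⊔n≤o⇒n≤o L₁ L₀ L₁⊔L₀≤L))
  where
  decay : ∃ λ L₀ → ∀ L → L₀ ℕ.≤ L → K * τ ^ℚ L < ε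
  decay = geometric-decay 0≤τ τ<1 0≤K 0<ε
  L₀ : ℕ
  L₀ = proj₁ decay

geometric-domination : ∀ (y : ℕ → ℚ) {α δ τ B M} → 0ℚ ≤ α → 0ℚ ≤ δ → 0ℚ ≤ M → 0ℚ ≤ y 0 →
  B ≤ δ * M → α + δ ≤ τ → (∀ L → y (suc L) ≤ α * y L + B * τ ^ℚ L) →
  ∀ L → y L ≤ (y 0 + M) * τ ^ℚ L
geometric-domination y {α} {δ} {τ} {B} {M} 0≤α 0≤δ 0≤M 0≤y₀ B≤δM α+δ≤τ step = bound
  where
  open ℚ.≤-Reasoning
  K : ℚ
  K = y 0 + M
  0≤K : 0ℚ ≤ K
  0≤K = +-nonNeg 0≤y₀ 0≤M
  0≤τ : 0ℚ ≤ τ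
  0≤τ = ℚ.≤-trans (+-nonNeg 0≤α 0≤δ) α+δ≤τ
  B≤δK : B ≤ δ * K
  B≤δK = ℚ.≤-trans B≤δM (*-monoˡ-≤-0≤ 0≤δ (p≤q+p 0≤y₀))
  bound : ∀ L → y L ≤ K * τ ^ℚ L
  bound zero    = ℚ.≤-trans (p≤p+q 0≤M) (ℚ.≤-reflexive (sym (ℚ.*-identityʳ K)))
  bound (suc L) = begin
    y (suc L)                         ≤⟨ step L ⟩
    α * y L + B * τ ^ℚ L              ≤⟨ ℚ.+-mono-≤ (*-monoˡ-≤-0≤ 0≤α (bound L))
                                                    (*-monoʳ-≤-0≤ (^ℚ-nonNeg L 0≤τ) B≤δK) ⟩
    α * (K * τ ^ℚ L) + δ * K * τ ^ℚ L ≡⟨ solve 4 (λ a d k t → a :* (k :* t) :+ d :* k :* t := (a :+ d) :* k :* t)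
                                           refl α δ K (τ ^ℚ L) ⟩
    (α + δ) * K * τ ^ℚ L              ≤⟨ *-monoʳ-≤-0≤ (^ℚ-nonNeg L 0≤τ) (*-monoʳ-≤-0≤ 0≤K α+δ≤τ) ⟩
    τ * K * τ ^ℚ L                    ≡⟨ solve 3 (λ t k p → t :* k :* p := k :* (t :* p)) refl τ K (τ ^ℚ L) ⟩
    K * τ ^ℚ suc L                    ∎

module DigitMeasure (b : ℕ) .{{_ : NonZero b}} (1<b : 1 ℕ.< b) (A : Subset b) where

  -- Base-b digits

  n<b^n : ∀ n → n ℕ.< b ℕ.^ n
  n<b^n zero    = z<s
  n<b^n (suc n) = ℕ.≤-<-trans (n<b^n n) (ℕ.^-monoʳ-< b 1<b (ℕ.n<1+n n))

  /b<b^ : ∀ {n} l → n ℕ.< b ℕ.^ suc l → n / b ℕ.< b ℕ.^ l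
  /b<b^ {n} l n<b^[1+l] = m<n*o⇒m/o<n (subst (n ℕ.<_) (ℕ.*-comm b (b ℕ.^ l)) n<b^[1+l])

  digitIn-%-cong : ∀ m n → m % b ≡ n % b → digitIn b A m ≡ digitIn b A n
  digitIn-%-cong m n eq = cong (λ d → does (d ∈? A)) (Fin.fromℕ<-cong _ _ eq (m%n<n m b) (m%n<n n b))

  -- The last l base-b digits of n, with leading zeros if n < b^l, all lie in A. The n < b^l with
  -- this property are exactly the atoms n/b^l of μ at level l: always if 0 ∈ A, for l ≥ 1 if 0 ∉ A.
  lowDigitsIn : ℕ → ℕ → Bool
  lowDigitsIn zero    n = true
  lowDigitsIn (suc l) n = digitIn b A n ∧ lowDigitsIn l (n / b)

  lowDigitsIn-split : ∀ l d r → r ℕ.< b ℕ.^ l →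
    lowDigitsIn (suc l) (d ℕ.* b ℕ.^ l ℕ.+ r) ≡ digitIn b A d ∧ lowDigitsIn l r
  lowDigitsIn-split zero d (suc r) (s≤s ())
  lowDigitsIn-split zero d zero _ =
    cong (λ n → digitIn b A n ∧ true) (trans (ℕ.+-identityʳ _) (ℕ.*-identityʳ d))
  lowDigitsIn-split (suc l) d r r<b^[1+l] = begin
    digitIn b A n ∧ lowDigitsIn (suc l) (n / b)
      ≡⟨ cong₂ (λ x m → x ∧ lowDigitsIn (suc l) m) (digitIn-%-cong n r n%b≡r%b) n/b≡ ⟩
    digitIn b A r ∧ lowDigitsIn (suc l) (d ℕ.* b ℕ.^ l ℕ.+ r / b)
      ≡⟨ cong (digitIn b A r ∧_) (lowDigitsIn-split l d (r / b) (/b<b^ l r<b^[1+l])) ⟩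
    digitIn b A r ∧ (digitIn b A d ∧ lowDigitsIn l (r / b))
      ≡⟨ ∧-swapˡ (digitIn b A r) (digitIn b A d) (lowDigitsIn l (r / b)) ⟩
    digitIn b A d ∧ (digitIn b A r ∧ lowDigitsIn l (r / b)) ∎
    where
    open ≡-Reasoning
    ∧-swapˡ : ∀ x y z → x ∧ (y ∧ z) ≡ y ∧ (x ∧ z)
    ∧-swapˡ x y z = trans (sym (∧-assoc x y z)) (trans (cong (_∧ z) (∧-comm x y)) (∧-assoc y x z))
    n : ℕ
    n = d ℕ.* b ℕ.^ suc l ℕ.+ r
    n≡ : n ≡ r ℕ.+ d ℕ.* b ℕ.^ l ℕ.* b
    n≡ = rearrange d b (b ℕ.^ l) r
      where
      rearrange : ∀ d b p r → d ℕ.* (b ℕ.* p) ℕ.+ r ≡ r ℕ.+ d ℕ.* p ℕ.* b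
      rearrange = solve-∀
    n%b≡r%b : n % b ≡ r % b
    n%b≡r%b = trans (cong (_% b) n≡) ([m+kn]%n≡m%n r (d ℕ.* b ℕ.^ l) b)
    n/b≡ : n / b ≡ d ℕ.* b ℕ.^ l ℕ.+ r / b
    n/b≡ = trans (cong (_/ b) n≡) (trans (+-distrib-/-∣ʳ r (divides-refl (d ℕ.* b ℕ.^ l)))
      (trans (cong (r / b ℕ.+_) (m*n/n≡m (d ℕ.* b ℕ.^ l) b)) (ℕ.+-comm (r / b) _)))

  digitsIn-zero : ∀ f → digitsIn b A f 0 ≡ true
  digitsIn-zero zero    = refl
  digitsIn-zero (suc f) = refl

  lowDigitsIn-zero : digitIn b A 0 ≡ true → ∀ l → lowDigitsIn l 0 ≡ true
  lowDigitsIn-zero 0∈A zero    = refl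
  lowDigitsIn-zero 0∈A (suc l) =
    cong₂ _∧_ 0∈A (trans (cong (lowDigitsIn l) (0/n≡0 b)) (lowDigitsIn-zero 0∈A l))

  lowDigitsIn-leadingZero : digitIn b A 0 ≡ false → ∀ l n → n ℕ.< b ℕ.^ l → lowDigitsIn (suc l) n ≡ false
  lowDigitsIn-leadingZero 0∉A zero    zero    _ = cong (_∧ true) 0∉A
  lowDigitsIn-leadingZero 0∉A zero    (suc n) (s≤s ())
  lowDigitsIn-leadingZero 0∉A (suc l) n       n<b^[1+l] =
    trans (cong (digitIn b A n ∧_) (lowDigitsIn-leadingZero 0∉A l (n / b) (/b<b^ l n<b^[1+l]))) (∧-zeroʳ _)

  digitsIn≡lowDigitsIn-padded : digitIn b A 0 ≡ true → ∀ l f n → n ℕ.< b ℕ.^ l → n ℕ.< b ℕ.^ f →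
    digitsIn b A f n ≡ lowDigitsIn l n
  digitsIn≡lowDigitsIn-padded 0∈A l       f       zero    _ _ =
    trans (digitsIn-zero f) (sym (lowDigitsIn-zero 0∈A l))
  digitsIn≡lowDigitsIn-padded 0∈A l       zero    (suc n) _ (s≤s ())
  digitsIn≡lowDigitsIn-padded 0∈A zero    (suc f) (suc n) (s≤s ()) _
  digitsIn≡lowDigitsIn-padded 0∈A (suc l) (suc f) (suc n) n<b^[1+l] n<b^[1+f] =
    cong (digitIn b A (suc n) ∧_)
      (digitsIn≡lowDigitsIn-padded 0∈A l f (suc n / b) (/b<b^ l n<b^[1+l]) (/b<b^ f n<b^[1+f]))

  digitsIn≡lowDigitsIn-exact : ∀ l f n → b ℕ.^ l ℕ.≤ n → n ℕ.< b ℕ.^ suc l → n ℕ.< b ℕ.^ f →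
    digitsIn b A f n ≡ lowDigitsIn (suc l) n
  digitsIn≡lowDigitsIn-exact l       f       zero    b^l≤0 _ _ = ⊥-elim (ℕ.<⇒≱ (ℕ.m^n>0 b l) b^l≤0)
  digitsIn≡lowDigitsIn-exact l       zero    (suc n) _ _ (s≤s ())
  digitsIn≡lowDigitsIn-exact zero    (suc f) (suc n) _ n<b^1 _ = cong (digitIn b A (suc n) ∧_)
    (trans (cong (digitsIn b A f) (m<n⇒m/n≡0 (subst (suc n ℕ.<_) (ℕ.*-identityʳ b) n<b^1))) (digitsIn-zero f))
  digitsIn≡lowDigitsIn-exact (suc l) (suc f) (suc n) b^[1+l]≤n n<b^[2+l] n<b^[1+f] =
    cong (digitIn b A (suc n) ∧_)
      (digitsIn≡lowDigitsIn-exact l f (suc n / b) b^l≤n/b (/b<b^ (suc l) n<b^[2+l]) (/b<b^ f n<b^[1+f]))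
    where
    b^l≤n/b : b ℕ.^ l ℕ.≤ suc n / b
    b^l≤n/b = subst (ℕ._≤ suc n / b) (m*n/n≡m (b ℕ.^ l) b)
      (/-monoˡ-≤ b (subst (ℕ._≤ suc n) (ℕ.*-comm b (b ℕ.^ l)) b^[1+l]≤n))

  lenAux-≤ : ∀ f l₀ n l → l₀ ℕ.≤ l → n ℕ.< b ℕ.^ l → lenAux b A f l₀ n ℕ.≤ l
  lenAux-≤ zero    l₀ n l l₀≤l _ = l₀≤l
  lenAux-≤ (suc f) l₀ n l l₀≤l n<b^l with n ℕ.<ᵇ b ℕ.^ l₀ in eq
  ... | true  = l₀≤l
  ... | false = lenAux-≤ f (suc l₀) n l (ℕ.≤∧≢⇒< l₀≤l l₀≢l) n<b^l
    where
    l₀≢l : l₀ ≢ l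
    l₀≢l refl = subst T eq (ℕ.<⇒<ᵇ n<b^l)

  lenAux-> : ∀ f l₀ n l → b ℕ.^ l ℕ.≤ n → l ℕ.< f ℕ.+ l₀ → l ℕ.< lenAux b A f l₀ n
  lenAux-> zero    l₀ n l _ l<l₀ = l<l₀
  lenAux-> (suc f) l₀ n l b^l≤n l<1+f+l₀ with n ℕ.<ᵇ b ℕ.^ l₀ in eq
  ... | true  = ℕ.≰⇒> λ l₀≤l →
    ℕ.<⇒≱ (ℕ.<ᵇ⇒< n (b ℕ.^ l₀) (subst T (sym eq) _)) (ℕ.≤-trans (ℕ.^-monoʳ-≤ b l₀≤l) b^l≤n)
  ... | false = lenAux-> f (suc l₀) n l b^l≤n (subst (l ℕ.<_) (sym (ℕ.+-suc f l₀)) l<1+f+l₀)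

  len<ᵇ1+l : ∀ {n l} → n ℕ.< b ℕ.^ l → (len b A n ℕ.<ᵇ suc l) ≡ true
  len<ᵇ1+l {n} {l} n<b^l = dec-true (len b A n ℕ.<? suc l) (s≤s (lenAux-≤ (suc n) 0 n l z≤n n<b^l))

  len≮ᵇ1+l : ∀ {n l} → b ℕ.^ l ℕ.≤ n → (len b A n ℕ.<ᵇ suc l) ≡ false
  len≮ᵇ1+l {n} {l} b^l≤n = dec-false (len b A n ℕ.<? suc l) (ℕ.<⇒≱ l<len ∘ ℕ.s≤s⁻¹)
    where
    l<len : l ℕ.< len b A n
    l<len = lenAux-> (suc n) 0 n l b^l≤n
      (subst (l ℕ.<_) (sym (ℕ.+-identityʳ (suc n))) (ℕ.m<n⇒m<1+n (ℕ.<-≤-trans (n<b^n l) b^l≤n)))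

  levelAtom≡lowDigitsIn-0∈A : digitIn b A 0 ≡ true → ∀ l n → n ℕ.< b ℕ.^ l →
    levelAtom b A l n ≡ lowDigitsIn l n
  levelAtom≡lowDigitsIn-0∈A 0∈A l n n<b^l rewrite 0∈A = trans (∧-identityʳ _) (admissible≡ n n<b^l)
    where
    admissible≡ : ∀ n → n ℕ.< b ℕ.^ l → admissible b A n ≡ lowDigitsIn l n
    admissible≡ zero    _     = trans 0∈A (sym (lowDigitsIn-zero 0∈A l))
    admissible≡ (suc n) n<b^l = digitsIn≡lowDigitsIn-padded 0∈A l (suc n) (suc n) n<b^l (n<b^n (suc n))

  levelAtom≡lowDigitsIn-0∉A : digitIn b A 0 ≡ false → ∀ l n → n ℕ.< b ℕ.^ suc l →
    levelAtom b A (suc l) n ≡ lowDigitsIn (suc l) n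
  levelAtom≡lowDigitsIn-0∉A 0∉A l n n<b^[1+l] rewrite 0∉A with b ℕ.^ l ℕ.≤? n
  ... | no b^l≰n = begin
    admissible b A n ∧ not (len b A n ℕ.<ᵇ suc l) ≡⟨ cong (λ β → admissible b A n ∧ not β)
                                                        (len<ᵇ1+l (ℕ.≰⇒> b^l≰n)) ⟩
    admissible b A n ∧ false                      ≡⟨ ∧-zeroʳ _ ⟩
    false                                         ≡⟨ lowDigitsIn-leadingZero 0∉A l n (ℕ.≰⇒> b^l≰n) ⟨
    lowDigitsIn (suc l) n                         ∎
    where open ≡-Reasoning
  ... | yes b^l≤n = begin
    admissible b A n ∧ not (len b A n ℕ.<ᵇ suc l) ≡⟨ cong (λ β → admissible b A n ∧ not β) (len≮ᵇ1+l b^l≤n) ⟩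
    admissible b A n ∧ true                       ≡⟨ ∧-identityʳ _ ⟩
    admissible b A n                              ≡⟨ admissible≡ n b^l≤n n<b^[1+l] ⟩
    lowDigitsIn (suc l) n                         ∎
    where
    open ≡-Reasoning
    admissible≡ : ∀ n → b ℕ.^ l ℕ.≤ n → n ℕ.< b ℕ.^ suc l → admissible b A n ≡ lowDigitsIn (suc l) n
    admissible≡ zero    b^l≤0 _         = ⊥-elim (ℕ.<⇒≱ (ℕ.m^n>0 b l) b^l≤0)
    admissible≡ (suc n) b^l≤n n<b^[1+l] =
      digitsIn≡lowDigitsIn-exact l (suc n) (suc n) b^l≤n n<b^[1+l] (n<b^n (suc n))

  -- Moments of the levels of μ

  b⁻¹ : ℚ
  b⁻¹ = invb b A

  b^l*b⁻¹^l≡1 : ∀ l → ℕ→ℚ (b ℕ.^ l) * b⁻¹ ^ℚ l ≡ 1ℚ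
  b^l*b⁻¹^l≡1 l = begin
    ℕ→ℚ (b ℕ.^ l) * b⁻¹ ^ℚ l ≡⟨ cong (_* b⁻¹ ^ℚ l) (ℕ→ℚ-^ b l) ⟩
    ℕ→ℚ b ^ℚ l * b⁻¹ ^ℚ l   ≡⟨ ^ℚ-distribʳ-* (ℕ→ℚ b) b⁻¹ l ⟨
    (ℕ→ℚ b * b⁻¹) ^ℚ l      ≡⟨ cong (_^ℚ l) (ℕ→ℚ*1/n≡1 b) ⟩
    1ℚ ^ℚ l                 ≡⟨ 1^ℚn≡1 l ⟩
    1ℚ                      ∎
    where open ≡-Reasoning

  point : ℕ → ℕ → ℚ
  point l n = ℕ→ℚ n * b⁻¹ ^ℚ l

  point-split : ∀ l d r → point (suc l) (d ℕ.* b ℕ.^ l ℕ.+ r) ≡ b⁻¹ * (ℕ→ℚ d + point l r)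
  point-split l d r = begin
    ℕ→ℚ (d ℕ.* b ℕ.^ l ℕ.+ r) * (b⁻¹ * b⁻¹ ^ℚ l)
      ≡⟨ cong (_* (b⁻¹ * b⁻¹ ^ℚ l))
           (trans (ℕ→ℚ-+ (d ℕ.* b ℕ.^ l) r) (cong (_+ ℕ→ℚ r) (ℕ→ℚ-* d (b ℕ.^ l)))) ⟩
    (ℕ→ℚ d * ℕ→ℚ (b ℕ.^ l) + ℕ→ℚ r) * (b⁻¹ * b⁻¹ ^ℚ l)
      ≡⟨ solve 5 (λ d B r x X → (d :* B :+ r) :* (x :* X) := x :* (d :* (B :* X) :+ r :* X)) refl
           (ℕ→ℚ d) (ℕ→ℚ (b ℕ.^ l)) (ℕ→ℚ r) b⁻¹ (b⁻¹ ^ℚ l) ⟩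
    b⁻¹ * (ℕ→ℚ d * (ℕ→ℚ (b ℕ.^ l) * b⁻¹ ^ℚ l) + point l r)
      ≡⟨ cong (λ t → b⁻¹ * (ℕ→ℚ d * t + point l r)) (b^l*b⁻¹^l≡1 l) ⟩
    b⁻¹ * (ℕ→ℚ d * 1ℚ + point l r)
      ≡⟨ cong (λ t → b⁻¹ * (t + point l r)) (ℚ.*-identityʳ (ℕ→ℚ d)) ⟩
    b⁻¹ * (ℕ→ℚ d + point l r) ∎
    where open ≡-Reasoning

  atomPower : ℕ → ℕ → ℕ → ℚ
  atomPower l m n = 𝟙[ lowDigitsIn l n ] * point l n ^ℚ m

  digitPower : ℕ → ℕ → ℚ
  digitPower j d = 𝟙[ digitIn b A d ] * ℕ→ℚ d ^ℚ j

  atomPower-split : ∀ l m d r → r ℕ.< b ℕ.^ l →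
    atomPower (suc l) m (d ℕ.* b ℕ.^ l ℕ.+ r)
      ≡ ∑[ j < suc m ] (b⁻¹ ^ℚ m * ℕ→ℚ (m C toℕ j)
                         * (digitPower (toℕ j) d * atomPower l (m ℕ.∸ toℕ j) r))
  atomPower-split l m d r r<b^l = begin
    𝟙[ lowDigitsIn (suc l) (d ℕ.* b ℕ.^ l ℕ.+ r) ] * point (suc l) (d ℕ.* b ℕ.^ l ℕ.+ r) ^ℚ m
      ≡⟨ cong₂ (λ β x → 𝟙[ β ] * x ^ℚ m) (lowDigitsIn-split l d r r<b^l) (point-split l d r) ⟩
    𝟙[ δ ∧ ρ ] * (b⁻¹ * (ℕ→ℚ d + point l r)) ^ℚ m
      ≡⟨ cong₂ _*_ (𝟙-∧ δ ρ) (^ℚ-distribʳ-* b⁻¹ _ m) ⟩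
    𝟙[ δ ] * 𝟙[ ρ ] * (b⁻¹ ^ℚ m * (ℕ→ℚ d + point l r) ^ℚ m)
      ≡⟨ cong (λ t → 𝟙[ δ ] * 𝟙[ ρ ] * (b⁻¹ ^ℚ m * t)) (binomial-theorem (ℕ→ℚ d) (point l r) m) ⟩
    𝟙[ δ ] * 𝟙[ ρ ] * (b⁻¹ ^ℚ m * ∑[ j < suc m ] term j)
      ≡⟨ trans (cong (𝟙[ δ ] * 𝟙[ ρ ] *_) (*-distribˡ-sum (b⁻¹ ^ℚ m) term))
           (*-distribˡ-sum (𝟙[ δ ] * 𝟙[ ρ ]) (λ j → b⁻¹ ^ℚ m * term j)) ⟩
    ∑[ j < suc m ] (𝟙[ δ ] * 𝟙[ ρ ] * (b⁻¹ ^ℚ m * term j))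
      ≡⟨ sum-cong-≗ {suc m} (λ j →
           solve 6 (λ u v x c y z → u :* v :* (x :* (c :* (y :* z))) := x :* c :* (u :* y :* (v :* z))) refl
             𝟙[ δ ] 𝟙[ ρ ] (b⁻¹ ^ℚ m) (ℕ→ℚ (m C toℕ j)) (ℕ→ℚ d ^ℚ toℕ j) (point l r ^ℚ (m ℕ.∸ toℕ j))) ⟩
    ∑[ j < suc m ] (b⁻¹ ^ℚ m * ℕ→ℚ (m C toℕ j) * (digitPower (toℕ j) d * atomPower l (m ℕ.∸ toℕ j) r)) ∎
    where
    open ≡-Reasoning
    δ ρ : Bool
    δ = digitIn b A d
    ρ = lowDigitsIn l r
    term : Fin (suc m) → ℚ
    term j = ℕ→ℚ (m C toℕ j) * (ℕ→ℚ d ^ℚ toℕ j * point l r ^ℚ (m ℕ.∸ toℕ j))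

  γ-digitPower : ∀ j → ℕ→ℚ (γ b A j) ≡ ∑[ d < b ] digitPower j (toℕ d)
  γ-digitPower j = begin
    ℕ→ℚ (foldr ℕ._+_ 0 (map g (allFin b))) ≡⟨ cong (ℕ→ℚ ∘ foldr ℕ._+_ 0) (List.map-tabulate (λ a → a) g) ⟩
    ℕ→ℚ (foldr ℕ._+_ 0 (tabulate g))       ≡⟨ ℕ→ℚ-sum-tabulate g ⟩
    ∑[ d < b ] ℕ→ℚ (g d)                   ≡⟨ sum-cong-≗ {b} ℕ→ℚ-g≡digitPower ⟩
    ∑[ d < b ] digitPower j (toℕ d)        ∎
    where
    open ≡-Reasoning
    g : Fin b → ℕ
    g a = if does (a ∈? A) then toℕ a ℕ.^ j else 0
    toℕ-mod : ∀ (a : Fin b) → toℕ a mod b ≡ a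
    toℕ-mod a = Fin.toℕ-injective (trans (Fin.toℕ-fromℕ< (m%n<n (toℕ a) b)) (m<n⇒m%n≡m (Fin.toℕ<n a)))
    ℕ→ℚ-g≡digitPower : ∀ a → ℕ→ℚ (g a) ≡ digitPower j (toℕ a)
    ℕ→ℚ-g≡digitPower a rewrite toℕ-mod a with does (a ∈? A)
    ... | true  = trans (ℕ→ℚ-^ (toℕ a) j) (sym (ℚ.*-identityˡ _))
    ... | false = sym (ℚ.*-zeroˡ (ℕ→ℚ (toℕ a) ^ℚ j))

  N≡γ0 : N b A ≡ γ b A 0
  N≡γ0 = trans (∣p∣≡count A)
    (cong (foldr ℕ._+_ 0) (sym (List.map-tabulate (λ a → a) (λ a → if does (a ∈? A) then 1 else 0))))

  sumA≡γ1 : sumA b A ≡ γ b A 1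
  sumA≡γ1 = cong (foldr ℕ._+_ 0) (List.map-cong
    (λ a → cong (λ x → if does (a ∈? A) then x else 0) (sym (ℕ.*-identityʳ (toℕ a)))) (allFin b))

  levelSum : ℕ → ℕ → ℚ
  levelSum m l = ∑[ n < b ℕ.^ l ] atomPower l m (toℕ n)

  coeff : ℕ → ℕ → ℚ
  coeff m j = ℕ→ℚ (m C j) * ℕ→ℚ (γ b A j)

  levelSum-suc : ∀ m l →
    levelSum m (suc l) ≡ b⁻¹ ^ℚ m * ∑[ j < suc m ] (coeff m (toℕ j) * levelSum (m ℕ.∸ toℕ j) l)
  levelSum-suc m l = begin
    ∑[ n < b ℕ.* b ℕ.^ l ] atomPower (suc l) m (toℕ n)
      ≡⟨ ∑-split-* b (b ℕ.^ l) (atomPower (suc l) m) ⟩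
    ∑[ d < b ] ∑[ r < b ℕ.^ l ] atomPower (suc l) m (toℕ d ℕ.* b ℕ.^ l ℕ.+ toℕ r)
      ≡⟨ sum-cong-≗ {b} (λ d → sum-cong-≗ {b ℕ.^ l} (λ r →
           atomPower-split l m (toℕ d) (toℕ r) (Fin.toℕ<n r))) ⟩
    ∑[ d < b ] ∑[ r < b ℕ.^ l ] ∑[ j < suc m ] term d r j
      ≡⟨ sum-cong-≗ {b} (λ d → ∑-comm (term d)) ⟩
    ∑[ d < b ] ∑[ j < suc m ] ∑[ r < b ℕ.^ l ] term d r j
      ≡⟨ ∑-comm (λ d j → ∑[ r < b ℕ.^ l ] term d r j) ⟩
    ∑[ j < suc m ] ∑[ d < b ] ∑[ r < b ℕ.^ l ] term d r j
      ≡⟨ sum-cong-≗ {suc m} (λ j → ∑∑-* {b} {b ℕ.^ l} (c j)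
           (λ d → digitPower (toℕ j) (toℕ d)) (λ r → atomPower l (m ℕ.∸ toℕ j) (toℕ r))) ⟩
    ∑[ j < suc m ] (c j * (∑[ d < b ] digitPower (toℕ j) (toℕ d) * levelSum (m ℕ.∸ toℕ j) l))
      ≡⟨ sum-cong-≗ {suc m} (λ j →
           cong (λ g → c j * (g * levelSum (m ℕ.∸ toℕ j) l)) (γ-digitPower (toℕ j))) ⟨
    ∑[ j < suc m ] (c j * (ℕ→ℚ (γ b A (toℕ j)) * levelSum (m ℕ.∸ toℕ j) l))
      ≡⟨ sum-cong-≗ {suc m} (λ j → solve 4 (λ x k g s → x :* k :* (g :* s) := x :* (k :* g :* s)) refl
           (b⁻¹ ^ℚ m) (ℕ→ℚ (m C toℕ j)) (ℕ→ℚ (γ b A (toℕ j))) (levelSum (m ℕ.∸ toℕ j) l)) ⟩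
    ∑[ j < suc m ] (b⁻¹ ^ℚ m * (coeff m (toℕ j) * levelSum (m ℕ.∸ toℕ j) l))
      ≡⟨ *-distribˡ-sum {suc m} (b⁻¹ ^ℚ m) (λ j → coeff m (toℕ j) * levelSum (m ℕ.∸ toℕ j) l) ⟨
    b⁻¹ ^ℚ m * ∑[ j < suc m ] (coeff m (toℕ j) * levelSum (m ℕ.∸ toℕ j) l) ∎
    where
    open ≡-Reasoning
    c : Fin (suc m) → ℚ
    c j = b⁻¹ ^ℚ m * ℕ→ℚ (m C toℕ j)
    term : Fin b → Fin (b ℕ.^ l) → Fin (suc m) → ℚ
    term d r j = c j * (digitPower (toℕ j) (toℕ d) * atomPower l (m ℕ.∸ toℕ j) (toℕ r))

  levelMoment : ℕ → ℕ → ℚ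
  levelMoment m l = b⁻¹ ^ℚ l * levelSum m l

  levelMoment-zero : ∀ m → levelMoment m 0 ≡ 0ℚ ^ℚ m
  levelMoment-zero m = solve 1 (λ z → con 1ℚ :* (con 1ℚ :* z :+ con 0ℚ) := z) refl (0ℚ ^ℚ m)

  levelMoment-suc : ∀ m l →
    levelMoment m (suc l) ≡ b⁻¹ ^ℚ suc m * ∑[ j < suc m ] (coeff m (toℕ j) * levelMoment (m ℕ.∸ toℕ j) l)
  levelMoment-suc m l = begin
    b⁻¹ ^ℚ suc l * levelSum m (suc l)
      ≡⟨ cong (b⁻¹ ^ℚ suc l *_) (levelSum-suc m l) ⟩
    b⁻¹ * b⁻¹ ^ℚ l * (b⁻¹ ^ℚ m * ∑[ j < suc m ] s j)
      ≡⟨ solve 4 (λ x p q t → x :* p :* (q :* t) := x :* q :* (p :* t)) refl b⁻¹ (b⁻¹ ^ℚ l) (b⁻¹ ^ℚ m) (sum s) ⟩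
    b⁻¹ ^ℚ suc m * (b⁻¹ ^ℚ l * ∑[ j < suc m ] s j)
      ≡⟨ cong (b⁻¹ ^ℚ suc m *_) (*-distribˡ-sum (b⁻¹ ^ℚ l) s) ⟩
    b⁻¹ ^ℚ suc m * ∑[ j < suc m ] (b⁻¹ ^ℚ l * s j)
      ≡⟨ cong (b⁻¹ ^ℚ suc m *_) (sum-cong-≗ {suc m} λ j → solve 3 (λ p c t → p :* (c :* t) := c :* (p :* t)) refl
           (b⁻¹ ^ℚ l) (coeff m (toℕ j)) (levelSum (m ℕ.∸ toℕ j) l)) ⟩
    b⁻¹ ^ℚ suc m * ∑[ j < suc m ] (coeff m (toℕ j) * levelMoment (m ℕ.∸ toℕ j) l) ∎
    where
    open ≡-Reasoning
    s : Fin (suc m) → ℚ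
    s j = coeff m (toℕ j) * levelSum (m ℕ.∸ toℕ j) l

  partialMoment : ℕ → ℕ → ℚ
  partialMoment m L = ∑[ l < L ] levelMoment m (toℕ l)

  partialMoment-suc : ∀ m L → partialMoment m (suc L)
    ≡ 0ℚ ^ℚ m + b⁻¹ ^ℚ suc m * ∑[ j < suc m ] (coeff m (toℕ j) * partialMoment (m ℕ.∸ toℕ j) L)
  partialMoment-suc m L = begin
    levelMoment m 0 + ∑[ l < L ] levelMoment m (suc (toℕ l))
      ≡⟨ cong₂ _+_ (levelMoment-zero m) (sum-cong-≗ {L} (λ l → levelMoment-suc m (toℕ l))) ⟩
    0ℚ ^ℚ m + ∑[ l < L ] (b⁻¹ ^ℚ suc m * ∑[ j < suc m ] term l j)
      ≡⟨ cong (0ℚ ^ℚ m +_) (*-distribˡ-sum (b⁻¹ ^ℚ suc m) (λ l → ∑[ j < suc m ] term l j)) ⟨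
    0ℚ ^ℚ m + b⁻¹ ^ℚ suc m * ∑[ l < L ] ∑[ j < suc m ] term l j
      ≡⟨ cong (λ t → 0ℚ ^ℚ m + b⁻¹ ^ℚ suc m * t) (∑-comm term) ⟩
    0ℚ ^ℚ m + b⁻¹ ^ℚ suc m * ∑[ j < suc m ] ∑[ l < L ] term l j
      ≡⟨ cong (λ t → 0ℚ ^ℚ m + b⁻¹ ^ℚ suc m * t) (sum-cong-≗ {suc m} λ j →
           *-distribˡ-sum {L} (coeff m (toℕ j)) (λ l → levelMoment (m ℕ.∸ toℕ j) (toℕ l))) ⟨
    0ℚ ^ℚ m + b⁻¹ ^ℚ suc m * ∑[ j < suc m ] (coeff m (toℕ j) * partialMoment (m ℕ.∸ toℕ j) L) ∎
    where
    open ≡-Reasoning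
    term : Fin L → Fin (suc m) → ℚ
    term l j = coeff m (toℕ j) * levelMoment (m ℕ.∸ toℕ j) (toℕ l)

  levelTerm≡levelMoment : ∀ m l → (∀ n → n ℕ.< b ℕ.^ l → levelAtom b A l n ≡ lowDigitsIn l n) →
    levelTerm b A m l ≡ levelMoment m l
  levelTerm≡levelMoment m l levelAtom≡ = cong (b⁻¹ ^ℚ l *_) (begin
    sumℚ (map atom (upTo (b ℕ.^ l)))   ≡⟨ cong sumℚ (List.map-upTo atom (b ℕ.^ l)) ⟩
    sumℚ (applyUpTo atom (b ℕ.^ l))    ≡⟨ sumℚ-applyUpTo (b ℕ.^ l) atom ⟩
    ∑[ n < b ℕ.^ l ] atom (toℕ n)      ≡⟨ sum-cong-≗ {b ℕ.^ l} (λ n → trans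
                                            (cong (λ β → if β then point l (toℕ n) ^ℚ m else 0ℚ)
                                              (levelAtom≡ (toℕ n) (Fin.toℕ<n n)))
                                            (if-then-0≡𝟙* (lowDigitsIn l (toℕ n)) (point l (toℕ n) ^ℚ m))) ⟩
    levelSum m l                       ∎)
    where
    open ≡-Reasoning
    atom : ℕ → ℚ
    atom n = if levelAtom b A l n then point l n ^ℚ m else 0ℚ

  -- Not for L = 0: if 0 ∉ A, the δ₀ term of μ stands in for the empty level 0.
  partialU≡partialMoment : ∀ m L → partialU b A m (suc L) ≡ partialMoment m (suc L)
  partialU≡partialMoment m L = by-zeroInA (digitIn b A 0) refl
    where
    open ≡-Reasoning
    deltaTerm≡ : ∀ {β} → digitIn b A 0 ≡ β → deltaTerm b A m ≡ (if β then 0ℚ else 0ℚ ^ℚ m)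
    deltaTerm≡ 0∈A? = cong (λ β → if β then 0ℚ else 0ℚ ^ℚ m) 0∈A?
    by-zeroInA : ∀ β → digitIn b A 0 ≡ β → partialU b A m (suc L) ≡ partialMoment m (suc L)
    by-zeroInA true 0∈A = begin
      deltaTerm b A m + sumℚ (applyUpTo (levelTerm b A m) (suc L))
        ≡⟨ cong₂ _+_ (deltaTerm≡ 0∈A) (sumℚ-applyUpTo (suc L) (levelTerm b A m)) ⟩
      0ℚ + ∑[ l < suc L ] levelTerm b A m (toℕ l)
        ≡⟨ trans (ℚ.+-identityˡ _) (sum-cong-≗ {suc L} (λ l →
             levelTerm≡levelMoment m (toℕ l) (levelAtom≡lowDigitsIn-0∈A 0∈A (toℕ l)))) ⟩
      partialMoment m (suc L) ∎
    by-zeroInA false 0∉A = begin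
      deltaTerm b A m + (levelTerm b A m 0 + sumℚ (applyUpTo (levelTerm b A m ∘ suc) L))
        ≡⟨ cong₂ (λ x y → x + (y + sumℚ (applyUpTo (levelTerm b A m ∘ suc) L))) (deltaTerm≡ 0∉A) levelTerm-zero ⟩
      0ℚ ^ℚ m + (0ℚ + sumℚ (applyUpTo (levelTerm b A m ∘ suc) L))
        ≡⟨ cong₂ _+_ (sym (levelMoment-zero m))
             (trans (ℚ.+-identityˡ _) (trans (sumℚ-applyUpTo L (levelTerm b A m ∘ suc)) (sum-cong-≗ {L} (λ l →
               levelTerm≡levelMoment m (suc (toℕ l)) (levelAtom≡lowDigitsIn-0∉A 0∉A (toℕ l)))))) ⟩
      partialMoment m (suc L) ∎
      where
      levelTerm-zero : levelTerm b A m 0 ≡ 0ℚ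
      levelTerm-zero = cong
        (λ β → 1ℚ * ((if β ∧ (β ∨ not (len b A 0 ℕ.<ᵇ 0)) then (ℕ→ℚ 0 * 1ℚ) ^ℚ m else 0ℚ) + 0ℚ)) 0∉A

  module Moments (N<b : N b A ℕ.< b) where

    D : ℕ → ℚ
    D m = ℕ→ℚ (b ℕ.^ suc m) - ℕ→ℚ (N b A)

    0<D : ∀ m → 0ℚ < D m
    0<D m = p<q⇒0<q-p (ℕ→ℚ-mono-< (ℕ.<-≤-trans N<b b≤b^[1+m]))
      where
      b≤b^[1+m] : b ℕ.≤ b ℕ.^ suc m
      b≤b^[1+m] = ℕ.m≤m*n b (b ℕ.^ m) {{ℕ.m^n≢0 b m}}

    D⁻¹ : ℕ → ℚ
    D⁻¹ m = ℚ.1/_ (D m) {{ℚ.>-nonZero (0<D m)}}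

    tailSum : (ℕ → ℚ) → ℕ → ℚ
    tailSum v m = ∑[ i < m ] (coeff m (suc (toℕ i)) * v (m ℕ.∸ suc (toℕ i)))

    -- u m = (b^(m+1) 0^m + Σ_{1 ≤ j ≤ m} C(m,j) γ_j u_{m-j}) / (b^(m+1) - N), a course-of-values
    -- recursion made structural by fuel: uFuel f m no longer depends on f once m < f.
    uFuel : ℕ → ℕ → ℚ
    uFuel zero    m = 0ℚ
    uFuel (suc f) m = (ℕ→ℚ (b ℕ.^ suc m) * 0ℚ ^ℚ m + tailSum (uFuel f) m) * D⁻¹ m

    u : ℕ → ℚ
    u m = uFuel (suc m) m

    m∸[1+i]<m : ∀ {m} (i : Fin m) → m ℕ.∸ suc (toℕ i) ℕ.< m
    m∸[1+i]<m {m} i = ℕ.∸-monoʳ-< {m} {suc (toℕ i)} {0} z<s (Fin.toℕ<n i)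

    uFuel-stable : ∀ f g m → m ℕ.< f → m ℕ.< g → uFuel f m ≡ uFuel g m
    uFuel-stable (suc f) (suc g) m (s≤s m≤f) (s≤s m≤g) =
      cong (λ t → (ℕ→ℚ (b ℕ.^ suc m) * 0ℚ ^ℚ m + t) * D⁻¹ m) (sum-cong-≗ {m} λ i → cong (coeff m (suc (toℕ i)) *_)
        (uFuel-stable f g _ (ℕ.<-≤-trans (m∸[1+i]<m i) m≤f) (ℕ.<-≤-trans (m∸[1+i]<m i) m≤g)))

    u-equation : ∀ m → D m * u m ≡ ℕ→ℚ (b ℕ.^ suc m) * 0ℚ ^ℚ m + tailSum u m
    u-equation m = begin
      D m * ((ℕ→ℚ (b ℕ.^ suc m) * 0ℚ ^ℚ m + tailSum (uFuel m) m) * D⁻¹ m)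
        ≡⟨ cong (λ t → D m * ((ℕ→ℚ (b ℕ.^ suc m) * 0ℚ ^ℚ m + t) * D⁻¹ m)) (sum-cong-≗ {m} λ i →
             cong (coeff m (suc (toℕ i)) *_) (uFuel-stable m _ _ (m∸[1+i]<m i) (ℕ.n<1+n _))) ⟩
      D m * (Y * D⁻¹ m)   ≡⟨ solve 3 (λ d y e → d :* (y :* e) := y :* (d :* e)) refl (D m) Y (D⁻¹ m) ⟩
      Y * (D m * D⁻¹ m)   ≡⟨ cong (Y *_) (ℚ.*-inverseʳ (D m) {{ℚ.>-nonZero (0<D m)}}) ⟩
      Y * 1ℚ              ≡⟨ ℚ.*-identityʳ Y ⟩
      Y                   ∎
      where
      open ≡-Reasoning
      Y : ℚ
      Y = ℕ→ℚ (b ℕ.^ suc m) * 0ℚ ^ℚ m + tailSum u m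

    coeff-0≡N : ∀ m → coeff m 0 ≡ ℕ→ℚ (N b A)
    coeff-0≡N m = trans (ℚ.*-identityˡ _) (cong ℕ→ℚ (sym N≡γ0))

    u-fixpoint : ∀ m → u m ≡ 0ℚ ^ℚ m + b⁻¹ ^ℚ suc m * ∑[ j < suc m ] (coeff m (toℕ j) * u (m ℕ.∸ toℕ j))
    u-fixpoint m = begin
      u m
        ≡⟨ trans (cong (_* u m) XB≡1) (ℚ.*-identityˡ (u m)) ⟨
      X * B * u m
        ≡⟨ solve 4 (λ x B n u → x :* B :* u := x :* ((B :- n) :* u) :+ x :* (n :* u)) refl X B N′ (u m) ⟩
      X * (D m * u m) + X * (N′ * u m)
        ≡⟨ cong (λ t → X * t + X * (N′ * u m)) (u-equation m) ⟩
      X * (B * z + rest) + X * (N′ * u m)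
        ≡⟨ solve 6 (λ x B z t n u → x :* (B :* z :+ t) :+ x :* (n :* u) := x :* B :* z :+ x :* (n :* u :+ t))
             refl X B z rest N′ (u m) ⟩
      X * B * z + X * (N′ * u m + rest)
        ≡⟨ cong₂ (λ s n → s * z + X * (n * u m + rest)) XB≡1 (sym (coeff-0≡N m)) ⟩
      1ℚ * z + X * (coeff m 0 * u m + rest)
        ≡⟨ cong (_+ X * (coeff m 0 * u m + rest)) (ℚ.*-identityˡ z) ⟩
      z + X * ∑[ j < suc m ] (coeff m (toℕ j) * u (m ℕ.∸ toℕ j)) ∎
      where
      open ≡-Reasoning
      X B N′ z rest : ℚ
      X = b⁻¹ ^ℚ suc m
      B = ℕ→ℚ (b ℕ.^ suc m)
      N′ = ℕ→ℚ (N b A)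
      z = 0ℚ ^ℚ m
      rest = tailSum u m
      XB≡1 : X * B ≡ 1ℚ
      XB≡1 = trans (ℚ.*-comm X B) (b^l*b⁻¹^l≡1 (suc m))

    error : ℕ → ℕ → ℚ
    error m L = u m - partialMoment m L

    error-suc : ∀ m L → error m (suc L) ≡ b⁻¹ ^ℚ suc m * ∑[ j < suc m ] (coeff m (toℕ j) * error (m ℕ.∸ toℕ j) L)
    error-suc m L = begin
      u m - partialMoment m (suc L)
        ≡⟨ cong₂ _-_ (u-fixpoint m) (partialMoment-suc m L) ⟩
      (0ℚ ^ℚ m + X * ∑[ j < suc m ] cu j) - (0ℚ ^ℚ m + X * ∑[ j < suc m ] cQ j)
        ≡⟨ solve 4 (λ z x p q → (z :+ x :* p) :- (z :+ x :* q) := x :* (p :- q)) refl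
             (0ℚ ^ℚ m) X (∑[ j < suc m ] cu j) (∑[ j < suc m ] cQ j) ⟩
      X * (∑[ j < suc m ] cu j - ∑[ j < suc m ] cQ j)
        ≡⟨ cong (X *_) (∑-distrib-- cu cQ) ⟨
      X * ∑[ j < suc m ] (cu j - cQ j)
        ≡⟨ cong (X *_) (sum-cong-≗ {suc m} λ j → solve 3 (λ c x y → c :* x :- c :* y := c :* (x :- y)) refl
             (coeff m (toℕ j)) (u (m ℕ.∸ toℕ j)) (partialMoment (m ℕ.∸ toℕ j) L)) ⟩
      X * ∑[ j < suc m ] (coeff m (toℕ j) * error (m ℕ.∸ toℕ j) L) ∎
      where
      open ≡-Reasoning
      X : ℚ
      X = b⁻¹ ^ℚ suc m
      cu cQ : Fin (suc m) → ℚ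
      cu j = coeff m (toℕ j) * u (m ℕ.∸ toℕ j)
      cQ j = coeff m (toℕ j) * partialMoment (m ℕ.∸ toℕ j) L

    0≤b⁻¹ : 0ℚ ≤ b⁻¹
    0≤b⁻¹ = ℚ.<⇒≤ (0<1/n b)

    b⁻¹≤1 : b⁻¹ ≤ 1ℚ
    b⁻¹≤1 = begin
      b⁻¹               ≡⟨ ℚ.*-identityˡ b⁻¹ ⟨
      1ℚ * b⁻¹          ≤⟨ *-monoʳ-≤-0≤ 0≤b⁻¹ (ℕ→ℚ-mono-≤ {1} {b} (ℕ.<⇒≤ 1<b)) ⟩
      ℕ→ℚ b * b⁻¹       ≡⟨ ℕ→ℚ*1/n≡1 b ⟩
      1ℚ                ∎
      where open ℚ.≤-Reasoning

    0≤coeff : ∀ m j → 0ℚ ≤ coeff m j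
    0≤coeff m j = *-nonNeg (0≤ℕ→ℚ (m C j)) (0≤ℕ→ℚ (γ b A j))

    ∣error-suc∣≤ : ∀ m L → ∣ error m (suc L) ∣
      ≤ b⁻¹ * ℕ→ℚ (N b A) * ∣ error m L ∣
        + b⁻¹ ^ℚ suc m * ∑[ i < m ] (coeff m (suc (toℕ i)) * ∣ error (m ℕ.∸ suc (toℕ i)) L ∣)
    ∣error-suc∣≤ m L = begin
      ∣ error m (suc L) ∣
        ≡⟨ trans (cong ∣_∣ (error-suc m L)) (∣c*x∣≡c*∣x∣ _ 0≤X) ⟩
      X * ∣ ∑[ j < suc m ] (coeff m (toℕ j) * error (m ℕ.∸ toℕ j) L) ∣
        ≤⟨ *-monoˡ-≤-0≤ 0≤X (∣∑∣≤∑∣∣ {suc m} (λ j → coeff m (toℕ j) * error (m ℕ.∸ toℕ j) L)) ⟩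
      X * ∑[ j < suc m ] ∣ coeff m (toℕ j) * error (m ℕ.∸ toℕ j) L ∣
        ≡⟨ cong (X *_) (sum-cong-≗ {suc m} λ j → ∣c*x∣≡c*∣x∣ (error (m ℕ.∸ toℕ j) L) (0≤coeff m (toℕ j))) ⟩
      X * (coeff m 0 * ∣ error m L ∣ + rest)
        ≡⟨ cong (λ c → X * (c * ∣ error m L ∣ + rest)) (coeff-0≡N m) ⟩
      X * (ℕ→ℚ (N b A) * ∣ error m L ∣ + rest)
        ≡⟨ solve 4 (λ x n e r → x :* (n :* e :+ r) := x :* n :* e :+ x :* r) refl X (ℕ→ℚ (N b A)) ∣ error m L ∣ rest ⟩
      X * ℕ→ℚ (N b A) * ∣ error m L ∣ + X * rest
        ≤⟨ ℚ.+-monoˡ-≤ (X * rest) (*-monoʳ-≤-0≤ (ℚ.0≤∣p∣ (error m L)) (*-monoʳ-≤-0≤ (0≤ℕ→ℚ (N b A)) X≤b⁻¹)) ⟩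
      b⁻¹ * ℕ→ℚ (N b A) * ∣ error m L ∣ + X * rest ∎
      where
      open ℚ.≤-Reasoning
      X rest : ℚ
      X = b⁻¹ ^ℚ suc m
      rest = ∑[ i < m ] (coeff m (suc (toℕ i)) * ∣ error (m ℕ.∸ suc (toℕ i)) L ∣)
      0≤X : 0ℚ ≤ X
      0≤X = ^ℚ-nonNeg (suc m) 0≤b⁻¹
      X≤b⁻¹ : X ≤ b⁻¹
      X≤b⁻¹ = ℚ.≤-trans (^ℚ-antimonoʳ-≤ 0≤b⁻¹ b⁻¹≤1 (s≤s (z≤n {m}))) (ℚ.≤-reflexive (ℚ.*-identityʳ b⁻¹))

    -- ∣ error m (L + 1) ∣ ≤ (N/b) ∣ error m L ∣ + (lower-order errors) and N/b ≤ 1 - 2δ, so the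
    -- rate τ = 1 - δ leaves the margin δ for the lower-order errors.
    δ τ : ℚ
    δ = ℚ.½ * b⁻¹
    τ = 1ℚ - δ

    0<δ : 0ℚ < δ
    0<δ = *-pos (ℚ.positive⁻¹ ℚ.½) (0<1/n b)

    τ<1 : τ < 1ℚ
    τ<1 = ℚ.<-≤-trans (ℚ.+-monoʳ-< 1ℚ (ℚ.neg-antimono-< 0<δ)) (ℚ.≤-reflexive (ℚ.+-identityʳ 1ℚ))

    α+δ≤τ : b⁻¹ * ℕ→ℚ (N b A) + δ ≤ τ
    α+δ≤τ = begin
      b⁻¹ * ℕ→ℚ (N b A) + δ        ≡⟨ solve 2 (λ x n → x :* n :+ con ℚ.½ :* x := x :* (con 1ℚ :+ n) :- con ℚ.½ :* x) refl
                                        b⁻¹ (ℕ→ℚ (N b A)) ⟩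
      b⁻¹ * (1ℚ + ℕ→ℚ (N b A)) - δ ≡⟨ cong (λ t → b⁻¹ * t - δ) (ℕ→ℚ-+ 1 (N b A)) ⟨
      b⁻¹ * ℕ→ℚ (suc (N b A)) - δ  ≤⟨ ℚ.+-monoˡ-≤ (- δ) (*-monoˡ-≤-0≤ 0≤b⁻¹ (ℕ→ℚ-mono-≤ N<b)) ⟩
      b⁻¹ * ℕ→ℚ b - δ              ≡⟨ cong (_- δ) (trans (ℚ.*-comm b⁻¹ (ℕ→ℚ b)) (ℕ→ℚ*1/n≡1 b)) ⟩
      τ                            ∎
      where open ℚ.≤-Reasoning

    0≤τ : 0ℚ ≤ τ
    0≤τ = ℚ.≤-trans (+-nonNeg (*-nonNeg 0≤b⁻¹ (0≤ℕ→ℚ (N b A))) (ℚ.<⇒≤ 0<δ)) α+δ≤τ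

    GeometricallyBounded : ℕ → ℚ → Set
    GeometricallyBounded m K = ∀ L → ∣ error m L ∣ ≤ K * τ ^ℚ L

    error-bound-step : ∀ m {K} → 0ℚ ≤ K → (∀ j → j ℕ.< m → GeometricallyBounded j K) →
      ∃ λ K′ → 0ℚ ≤ K′ × GeometricallyBounded m K′
    error-bound-step m {K} 0≤K bounded = ∣ error m 0 ∣ + M , +-nonNeg (ℚ.0≤∣p∣ (error m 0)) 0≤M ,
      geometric-domination (λ L → ∣ error m L ∣) (*-nonNeg 0≤b⁻¹ (0≤ℕ→ℚ (N b A))) (ℚ.<⇒≤ 0<δ) 0≤M
        (ℚ.0≤∣p∣ (error m 0)) (ℚ.≤-reflexive (sym δM≡B)) α+δ≤τ step
      where
      open ℚ.≤-Reasoning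
      X : ℚ
      X = b⁻¹ ^ℚ suc m
      c : Fin m → ℚ
      c i = coeff m (suc (toℕ i))
      B M : ℚ
      B = X * sum c * K
      M = (1ℚ + 1ℚ) * ℕ→ℚ b * B
      0≤M : 0ℚ ≤ M
      0≤M = *-nonNeg (*-nonNeg (ℚ.nonNegative⁻¹ (1ℚ + 1ℚ)) (0≤ℕ→ℚ b))
        (*-nonNeg (*-nonNeg (^ℚ-nonNeg (suc m) 0≤b⁻¹) (∑-nonNeg {m} (λ i → 0≤coeff m (suc (toℕ i))))) 0≤K)
      δM≡B : δ * M ≡ B
      δM≡B = begin-equality
        ℚ.½ * b⁻¹ * ((1ℚ + 1ℚ) * ℕ→ℚ b * B)
          ≡⟨ solve 3 (λ x n y → con ℚ.½ :* x :* ((con 1ℚ :+ con 1ℚ) :* n :* y) := n :* x :* y) refl b⁻¹ (ℕ→ℚ b) B ⟩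
        ℕ→ℚ b * b⁻¹ * B
          ≡⟨ cong (_* B) (ℕ→ℚ*1/n≡1 b) ⟩
        1ℚ * B
          ≡⟨ ℚ.*-identityˡ B ⟩
        B ∎
      step : ∀ L → ∣ error m (suc L) ∣ ≤ b⁻¹ * ℕ→ℚ (N b A) * ∣ error m L ∣ + B * τ ^ℚ L
      step L = ℚ.≤-trans (∣error-suc∣≤ m L) (ℚ.+-monoʳ-≤ (b⁻¹ * ℕ→ℚ (N b A) * ∣ error m L ∣) (begin
        X * ∑[ i < m ] (c i * ∣ error (m ℕ.∸ suc (toℕ i)) L ∣)
          ≤⟨ *-monoˡ-≤-0≤ (^ℚ-nonNeg (suc m) 0≤b⁻¹) (∑-mono-≤ λ i →
               *-monoˡ-≤-0≤ (0≤coeff m (suc (toℕ i))) (bounded _ (m∸[1+i]<m i) L)) ⟩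
        X * ∑[ i < m ] (c i * (K * τ ^ℚ L))
          ≡⟨ cong (X *_) (*-distribʳ-sum (K * τ ^ℚ L) c) ⟨
        X * (sum c * (K * τ ^ℚ L))
          ≡⟨ solve 4 (λ x s k t → x :* (s :* (k :* t)) := x :* s :* k :* t) refl X (sum c) K (τ ^ℚ L) ⟩
        B * τ ^ℚ L ∎))
    error-bound : ∀ m → ∃ λ K → 0ℚ ≤ K × (∀ j → j ℕ.≤ m → GeometricallyBounded j K)
    error-bound zero = proj₁ step₀ , proj₁ (proj₂ step₀) , λ { zero z≤n → proj₂ (proj₂ step₀) }
      where
      step₀ : ∃ λ K → 0ℚ ≤ K × GeometricallyBounded 0 K
      step₀ = error-bound-step 0 ℚ.≤-refl (λ _ ())
    error-bound (suc m) = K + K′ , +-nonNeg 0≤K 0≤K′ , bounded″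
      where
      K : ℚ
      K = proj₁ (error-bound m)
      0≤K : 0ℚ ≤ K
      0≤K = proj₁ (proj₂ (error-bound m))
      bounded : ∀ j → j ℕ.≤ m → GeometricallyBounded j K
      bounded = proj₂ (proj₂ (error-bound m))
      next : ∃ λ K′ → 0ℚ ≤ K′ × GeometricallyBounded (suc m) K′
      next = error-bound-step (suc m) 0≤K (λ j j<1+m → bounded j (ℕ.s≤s⁻¹ j<1+m))
      K′ : ℚ
      K′ = proj₁ next
      0≤K′ : 0ℚ ≤ K′
      0≤K′ = proj₁ (proj₂ next)
      weaken : ∀ j {K₁} → K₁ ≤ K + K′ → GeometricallyBounded j K₁ → GeometricallyBounded j (K + K′)
      weaken j K₁≤ bound L = ℚ.≤-trans (bound L) (*-monoʳ-≤-0≤ (^ℚ-nonNeg L 0≤τ) K₁≤)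
      bounded″ : ∀ j → j ℕ.≤ suc m → GeometricallyBounded j (K + K′)
      bounded″ j j≤1+m =
        [ (λ j<1+m → weaken j K≤K+K′ (bounded j (ℕ.s≤s⁻¹ j<1+m)))
        , (λ j≡1+m → subst (λ i → GeometricallyBounded i (K + K′)) (sym j≡1+m)
                       (weaken (suc m) K′≤K+K′ (proj₂ (proj₂ next))))
        ]′ (ℕ.m≤n⇒m<n∨m≡n j≤1+m)
        where
        K≤K+K′ : K ≤ K + K′
        K≤K+K′ = p≤p+q 0≤K′
        K′≤K+K′ : K′ ≤ K + K′
        K′≤K+K′ = p≤q+p 0≤K

    u-convergesTo : ∀ m → ConvergesTo (partialU b A m) (u m)
    u-convergesTo m = geometric-bound⇒convergesTo 0≤τ τ<1 0≤K (partialU b A m) (u m) 1 bound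
      where
      K : ℚ
      K = proj₁ (error-bound m)
      0≤K : 0ℚ ≤ K
      0≤K = proj₁ (proj₂ (error-bound m))
      bound : ∀ L → 1 ℕ.≤ L → ∣ partialU b A m L - u m ∣ ≤ K * τ ^ℚ L
      bound (suc L) _ = begin
        ∣ partialU b A m (suc L) - u m ∣     ≡⟨ cong (λ p → ∣ p - u m ∣) (partialU≡partialMoment m L) ⟩
        ∣ partialMoment m (suc L) - u m ∣    ≡⟨ cong ∣_∣ (solve 2 (λ p q → p :- q := :- (q :- p)) refl
                                                   (partialMoment m (suc L)) (u m)) ⟩
        ∣ - error m (suc L) ∣                ≡⟨ ℚ.∣-p∣≡∣p∣ (error m (suc L)) ⟩
        ∣ error m (suc L) ∣                  ≤⟨ proj₂ (proj₂ (error-bound m)) m ℕ.≤-refl (suc L) ⟩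
        K * τ ^ℚ suc L                       ∎
        where open ℚ.≤-Reasoning

    u-recurrence : ∀ m → 1 ℕ.≤ m →
      D m * u m ≡ sum1to m (λ j → ℕ→ℚ (m C j) * ℕ→ℚ (γ b A j) * u (m ℕ.∸ j))
    u-recurrence (suc m) _ = begin
      D (suc m) * u (suc m)
        ≡⟨ u-equation (suc m) ⟩
      B * 0ℚ ^ℚ suc m + tailSum u (suc m)
        ≡⟨ cong (λ z → B * z + tailSum u (suc m)) (0^ℚsuc≡0 m) ⟩
      B * 0ℚ + tailSum u (suc m)
        ≡⟨ solve 2 (λ B t → B :* con 0ℚ :+ t := t) refl B (tailSum u (suc m)) ⟩
      tailSum u (suc m)
        ≡⟨ sumℚ-applyUpTo (suc m) (λ i → coeff (suc m) (suc i) * u (m ℕ.∸ i)) ⟨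
      sum1to (suc m) (λ j → ℕ→ℚ (suc m C j) * ℕ→ℚ (γ b A j) * u (suc m ℕ.∸ j)) ∎
      where
      open ≡-Reasoning
      B : ℚ
      B = ℕ→ℚ (b ℕ.^ suc (suc m))

    u-zero : u 0 * (ℕ→ℚ b - ℕ→ℚ (N b A)) ≡ ℕ→ℚ b
    u-zero = begin
      u 0 * (ℕ→ℚ b - ℕ→ℚ (N b A))  ≡⟨ ℚ.*-comm (u 0) _ ⟩
      (ℕ→ℚ b - ℕ→ℚ (N b A)) * u 0  ≡⟨ cong (λ x → (ℕ→ℚ x - ℕ→ℚ (N b A)) * u 0) (ℕ.*-identityʳ b) ⟨
      D 0 * u 0                    ≡⟨ u-equation 0 ⟩
      ℕ→ℚ (b ℕ.* 1) * 1ℚ + 0ℚ      ≡⟨ solve 1 (λ x → x :* con 1ℚ :+ con 0ℚ := x) refl (ℕ→ℚ (b ℕ.* 1)) ⟩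
      ℕ→ℚ (b ℕ.* 1)                ≡⟨ cong ℕ→ℚ (ℕ.*-identityʳ b) ⟩
      ℕ→ℚ b                        ∎
      where open ≡-Reasoning

    u-one : u 1 * ((ℕ→ℚ (b ℕ.^ 2) - ℕ→ℚ (N b A)) * (ℕ→ℚ b - ℕ→ℚ (N b A))) ≡ ℕ→ℚ (sumA b A) * ℕ→ℚ b
    u-one = begin
      u 1 * (D 1 * D₀)
        ≡⟨ solve 3 (λ u d e → u :* (d :* e) := d :* u :* e) refl (u 1) (D 1) D₀ ⟩
      D 1 * u 1 * D₀
        ≡⟨ cong (_* D₀) (u-equation 1) ⟩
      (B * 0ℚ ^ℚ 1 + (1ℚ * γ₁ * u 0 + 0ℚ)) * D₀
        ≡⟨ cong (λ z → (B * z + (1ℚ * γ₁ * u 0 + 0ℚ)) * D₀) (0^ℚsuc≡0 0) ⟩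
      (B * 0ℚ + (1ℚ * γ₁ * u 0 + 0ℚ)) * D₀
        ≡⟨ solve 4 (λ B g u d → (B :* con 0ℚ :+ (con 1ℚ :* g :* u :+ con 0ℚ)) :* d := g :* (u :* d))
             refl B γ₁ (u 0) D₀ ⟩
      γ₁ * (u 0 * D₀)
        ≡⟨ cong₂ _*_ (cong ℕ→ℚ (sym sumA≡γ1)) u-zero ⟩
      ℕ→ℚ (sumA b A) * ℕ→ℚ b ∎
      where
      open ≡-Reasoning
      B γ₁ D₀ : ℚ
      B = ℕ→ℚ (b ℕ.^ 2)
      γ₁ = ℕ→ℚ (γ b A 1)
      D₀ = ℕ→ℚ b - ℕ→ℚ (N b A)

proposition2 : (b : ℕ) .{{_ : NonZero b}} → 1 ℕ.< b →
    (A : Subset b) → A ⊂ ⊤ → A ≢ ⁅ 0 mod b ⁆ →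
    ∃ λ (u : ℕ → ℚ) →
      (∀ m → ConvergesTo (partialU b A m) (u m))
      × (∀ m → 1 ℕ.≤ m →
           (ℕ→ℚ (b ℕ.^ suc m) - ℕ→ℚ (N b A)) * u m
             ≡ sum1to m (λ j → ℕ→ℚ (m C j) * ℕ→ℚ (γ b A j) * u (m ℕ.∸ j)))
      × (u 0 * (ℕ→ℚ b - ℕ→ℚ (N b A)) ≡ ℕ→ℚ b)
      × (u 1 * ((ℕ→ℚ (b ℕ.^ 2) - ℕ→ℚ (N b A)) * (ℕ→ℚ b - ℕ→ℚ (N b A)))
           ≡ ℕ→ℚ (sumA b A) * ℕ→ℚ b)
proposition2 b 1<b A A⊂⊤ _ = u , u-convergesTo , u-recurrence , u-zero , u-one
  where
  N<b : N b A ℕ.< b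
  N<b = subst (N b A ℕ.<_) (∣⊤∣≡n b) (p⊂q⇒∣p∣<∣q∣ A⊂⊤)
  open DigitMeasure b 1<b A
  open Moments N<b
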